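{- Let $H_1$ and $H_2$ be disjoint ribbon hypermaps, let $H_1\cup H_2$ be their disjoint union, and let $H_1\vee H_2$ be a one-vertex-joint of them. Then $${}^{\partial}\varepsilon_{H_{1}\cup H_{2}}(z)={}^{\partial}\varepsilon_{H_{1}\vee H_{2}}(z)={}^{\partial}\varepsilon_{H_{1}}(z)\,{}^{\partial}\varepsilon_{H_{2}}(z).$$
   Context: A ribbon hypermap $H$ is a (possibly non-orientable) surface with boundary, written as the union of two sets of discs, the hypervertices $V(H)$ and the hyperedges $E(H)$, such that hypervertices and hyperedges meet in disjoint line segments (common line segments), each lying on the boundary of exactly one hypervertex and exactly one hyperedge. Hyperfaces are the boundary components of the surface. $v(H),e(H),f(H),k(H)$ are the numbers of hypervertices, hyperedges, hyperfaces and connected components; $d(e)$ is the number of common line segments on hyperedge $e$ and $d(H)=\sum_e d(e)$. The Euler genus is $\varepsilon(H)=2k(H)+d(H)-v(H)-e(H)-f(H)$. Partial dual $H^A$ ($A\subseteq E(H)$): in an arrow presentation of $H$ (hypervertices as closed curves; each hyperedge $e$ as arrows $e_1,\dots,e_{d(e)}$ along its common line segments in cyclic order around $e$), for each $e\in A$ and each $i$ draw a new arrow from the head of $e_i$ to the tail of $e_{i+1}$ (indices mod $d(e)$), label it $e_i$, and delete the original arrows; the new arrows become arcs of the closed curves of the arrow presentation of $H^A$. The partial-dual polynomial is ${}^{\partial}\varepsilon_{H}(z)=\sum_{A\subseteq E(H)} z^{\varepsilon(H^A)}$. The disjoint union $H_1\cup H_2$ takes the unions of hypervertices, hyperedges and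 hyperfaces. A one-vertex-joint $H_1\vee H_2$ is formed by choosing an arc $p_1$ on the boundary of a hypervertex $v_1$ of $H_1$ lying between two consecutive hyperedge ends, and such an arc $p_2$ on the boundary of a hypervertex $v_2$ of $H_2$, and pasting $v_1$ and $v_2$ together by identifying $p_1$ and $p_2$. -}

module Defs where

open import Data.Bool using (Bool; true; false; if_then_else_; _∧_; _∨_; not; T)
open import Data.Nat using (ℕ; zero; suc; _+_; _*_; _∸_; _^_; _<ᵇ_)
open import Data.Fin using (Fin; toℕ; _↑ˡ_; _↑ʳ_; splitAt)
import Data.Fin as Fin
open import Data.Fin.Properties using () renaming (_≟_ to _≟ᶠ_)
open import Data.Nat.Properties using (_≟_)
open import Data.Sum using ([_,_]′)
open import Data.List using (List; []; _∷_; map; allFin; upTo; _++_; length; filter)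
open import Data.Bool.ListAction using (any)
open import Data.Nat.ListAction using (sum)
open import Data.Vec using (Vec; []; _∷_; lookup; _++_)
open import Data.Product using (∃; _×_; _,_)
open import Relation.Nullary.Decidable using (⌊_⌋)
open import Relation.Binary.PropositionalEquality using (_≡_; _≢_)

-- Points: the 2 d(H) endpoints of the common line segments, as Fin n.
--   α : swaps the two endpoints of a common line segment;
--   β : swaps the two endpoints of a hypervertex-boundary arc between
--       consecutive common line segments;
--   γ : swaps the two endpoints of a hyperedge-boundary arc between
--       consecutive common line segments.
-- edge : labels each point by its hyperedge (Fin m = E(H)).
-- iso  : number of hypervertices meeting no hyperedge (isolated discs).

record RawHypermap : Set where
  constructor raw
  field
    n m iso : ℕ
    α β γ   : Fin n → Fin n
    edge    : Fin n → Fin m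
open RawHypermap public

reachFrom : ∀ {n} → List (Fin n → Fin n) → ℕ → Fin n → Fin n → Bool
reachFrom gs zero    x y = ⌊ x ≟ᶠ y ⌋
reachFrom {n} gs (suc k) x y =
  reachFrom gs k x y ∨
  any (λ z → reachFrom gs k x z ∧ any (λ g → ⌊ g z ≟ᶠ y ⌋) gs) (allFin n)

-- same orbit of the group generated by gs (n steps suffice)
sameOrbit : ∀ {n} → List (Fin n → Fin n) → Fin n → Fin n → Bool
sameOrbit {n} gs x y = reachFrom gs n x y

orbits : ∀ {n} → List (Fin n → Fin n) → ℕ
orbits {n} gs = sum (map (λ x → if isMin x then 1 else 0) (allFin n))
  where
  isMin : Fin n → Bool
  isMin x = not (any (λ y → (toℕ y <ᵇ toℕ x) ∧ sameOrbit gs x y) (allFin n))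

Involution : ∀ {n} → (Fin n → Fin n) → Set
Involution f = ∀ x → f (f x) ≡ x

FixedPointFree : ∀ {n} → (Fin n → Fin n) → Set
FixedPointFree f = ∀ x → f x ≢ x

record IsHypermap (H : RawHypermap) : Set where
  field
    α-inv : Involution (α H)
    β-inv : Involution (β H)
    γ-inv : Involution (γ H)
    α-fpf : FixedPointFree (α H)
    β-fpf : FixedPointFree (β H)
    γ-fpf : FixedPointFree (γ H)
    edge-α : ∀ x → edge H (α H x) ≡ edge H x
    edge-γ : ∀ x → edge H (γ H x) ≡ edge H x
    edge-surj : ∀ e → ∃ λ x → edge H x ≡ e
    edge-orbit : ∀ x y → edge H x ≡ edge H y → T (sameOrbit (α H ∷ γ H ∷ []) x y)

record Hypermap : Set where
  constructor hypermap
  field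
    carrier : RawHypermap
    valid   : IsHypermap carrier
open Hypermap public

kH vH eH fH dH : RawHypermap → ℕ
kH H = orbits (α H ∷ β H ∷ γ H ∷ []) + iso H
vH H = orbits (α H ∷ β H ∷ []) + iso H
eH H = orbits (α H ∷ γ H ∷ [])
fH H = orbits (β H ∷ γ H ∷ []) + iso H
dH H = orbits (α H ∷ [])

-- ε(H) = 2k + d - v - e - f  (always ≥ 0 for a genuine surface)
eulerGenus : RawHypermap → ℕ
eulerGenus H = (2 * kH H + dH H) ∸ (vH H + eH H + fH H)

-- Partial duality: for points on hyperedges in A, the common line
-- segments and the hyperedge-boundary arcs exchange roles.

Subset : ℕ → Set
Subset m = Vec Bool m

partialDual : (H : RawHypermap) → Subset (m H) → RawHypermap
partialDual (raw n m iso α β γ edge) A =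
  raw n m iso
    (λ x → if lookup A (edge x) then γ x else α x)
    β
    (λ x → if lookup A (edge x) then α x else γ x)
    edge

allSubsets : (m : ℕ) → List (Subset m)
allSubsets zero    = [] ∷ []
allSubsets (suc m) = map (true ∷_) (allSubsets m) Data.List.++ map (false ∷_) (allSubsets m)

Poly : Set
Poly = ℕ → ℕ

_⊛_ : Poly → Poly → Poly
(p ⊛ q) k = sum (map (λ i → p i * q (k ∸ i)) (upTo (suc k)))

partialDualPoly : RawHypermap → Poly
partialDualPoly H k =
  length (filter (λ A → eulerGenus (partialDual H A) ≟ k)
                 (allSubsets (m H)))

_⊕_ : ∀ {a b c d} → (Fin a → Fin c) → (Fin b → Fin d) → Fin (a + b) → Fin (c + d)
_⊕_ {a} {b} {c} {d} f g x = [ (λ y → f y ↑ˡ d) , (λ y → c ↑ʳ g y) ]′ (splitAt a x)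

rawUnion : RawHypermap → RawHypermap → RawHypermap
rawUnion H₁ H₂ =
  raw (n H₁ + n H₂) (m H₁ + m H₂) (iso H₁ + iso H₂)
      (α H₁ ⊕ α H₂) (β H₁ ⊕ β H₂) (γ H₁ ⊕ γ H₂) (edge H₁ ⊕ edge H₂)


reglue : ∀ {n} → (Fin n → Fin n) → Fin n → Fin n → Fin n → Fin n → Fin n → Fin n
reglue β a b c d x =
  if ⌊ x ≟ᶠ a ⌋ then c else
  if ⌊ x ≟ᶠ c ⌋ then a else
  if ⌊ x ≟ᶠ b ⌋ then d else
  if ⌊ x ≟ᶠ d ⌋ then b else β x

-- One-vertex-joint: the arc p₁ lies on the hypervertex-boundary arc of
-- H₁ from x₁ to β₁ x₁, the arc p₂ on the arc of H₂ from x₂ to β₂ x₂;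
-- they are identified so that the x₁-end of p₁ meets the x₂-end of p₂
-- (choosing β₂ x₂ instead of x₂ gives the other orientation).
rawJoint : (H₁ H₂ : RawHypermap) → Fin (n H₁) → Fin (n H₂) → RawHypermap
rawJoint H₁ H₂ x₁ x₂ =
  raw (n H₁ + n H₂) (m H₁ + m H₂) (iso H₁ + iso H₂)
      (α H₁ ⊕ α H₂)
      (reglue (β H₁ ⊕ β H₂)
              (x₁ ↑ˡ n H₂) (β H₁ x₁ ↑ˡ n H₂)
              (n H₁ ↑ʳ x₂) (n H₁ ↑ʳ β H₂ x₂))
      (γ H₁ ⊕ γ H₂) (edge H₁ ⊕ edge H₂)

-- Partial duality commutes with disjoint union: the partial dual of H₁ ∪ H₂ along A₁ ⊔ A₂ is the union of
-- the partial duals of H₁ along A₁ and of H₂ along A₂. All orbit counts add over a union, hence so does the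
-- Euler genus once it is known never to be negative (the definition uses truncated subtraction), and counting
-- subsets by genus turns this additivity into the product of the two polynomials.
-- A one-vertex-joint reglues two β-arcs. In every partial dual this fuses the two vertices, the two faces and
-- the two components through the joint and leaves hyperedges and segments alone, so the genus is unchanged.
-- Nonnegativity is proved by descent on the number of points where β or γ differs from α: regluing β (or γ)
-- to agree with α at such a point does not decrease v + e + f − 2k, and once β = γ = α every orbit count
-- equals d.

module Submission where

open import Defs
open import Data.Bool using (Bool; true; false; T; not; _∧_; _∨_; if_then_else_)
open import Data.Bool.Properties using (T-∨; T-∧; T?; if-float)
open import Data.Bool.ListAction using (any)
open import Data.Empty using (⊥; ⊥-elim)
open import Data.Fin using (Fin; zero; suc; toℕ; _↑ˡ_; _↑ʳ_; splitAt)
open import Data.Fin.Properties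
  using (all?; ¬∀⟶∃¬; pigeonhole; toℕ-injective; toℕ≤pred[n]; toℕ<n; toℕ-↑ˡ; toℕ-↑ʳ; splitAt-↑ˡ; splitAt-↑ʳ; ↑ˡ-injective; ↑ʳ-injective)
  renaming (_≟_ to _≟ᶠ_)
open import Data.List using (List; []; _∷_; _++_; zipWith; map; allFin; tabulate; applyUpTo; upTo; length; filter)
open import Data.List.Membership.Propositional using (lose)
open import Data.List.Membership.Propositional.Properties using (∈-allFin)
open import Data.List.Properties using (map-tabulate; map-cong; length-++; filter-++; filter-≐; filter-none; filter-accept; filter-reject)
open import Data.List.Relation.Unary.All using (All; []; _∷_; lookupAny; universal)
open import Data.List.Relation.Unary.Any using (Any; here; there; satisfied)
open import Data.List.Relation.Unary.Any.Properties using (any⁺; any⁻)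
open import Data.Nat using (ℕ; zero; suc; _+_; _*_; _∸_; _≤_; _<_; z≤n; s≤s; _<ᵇ_; _≤?_)
open import Data.Nat.ListAction using (sum)
open import Data.Nat.Properties
open import Data.Nat.Tactic.RingSolver using (solve-∀)
open import Relation.Unary using (Decidable)
open import Algebra.Properties.CommutativeSemigroup +-commutativeSemigroup using (interchange)
open import Data.Product using (∃; _×_; _,_; proj₁; proj₂)
open import Data.Vec using ([]; _∷_; lookup) renaming (_++_ to _++ᵥ_; splitAt to splitAtᵥ)
open import Data.Vec.Properties using (lookup-++ˡ; lookup-++ʳ)
open import Data.Sum using (_⊎_; inj₁; inj₂; [_,_]′)
open import Function using (_∘_; _⇔_; mk⇔; Equivalence)
open import Relation.Binary using (Rel; tri<; tri≈; tri>)
open import Relation.Binary.Construct.Closure.ReflexiveTransitive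
  using (Star; ε; _◅_; _◅◅_; fold; reverse; kleisliStar; return)
open import Data.List.Relation.Binary.Pointwise using (Pointwise; []; _∷_)
open import Relation.Binary.PropositionalEquality
open import Relation.Nullary using (¬_; Dec; yes; no; does)
open import Relation.Nullary.Decidable using (⌊_⌋; toWitness; fromWitness)
open import Algebra.Properties.CommutativeMonoid.Sum +-0-commutativeMonoid
  using (sum-cong-≗; sum-replicate-zero; ∑-distrib-+) renaming (sum to ∑)

any-allFin⁻ : ∀ {n} (p : Fin n → Bool) → T (any p (allFin n)) → ∃ λ i → T (p i)
any-allFin⁻ {n} p h = satisfied (any⁻ p (allFin n) h)

any-allFin⁺ : ∀ {n} (p : Fin n → Bool) i → T (p i) → T (any p (allFin n))
any-allFin⁺ p i h = any⁺ p (lose (∈-allFin i) h)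

Generators : ℕ → Set
Generators n = List (Fin n → Fin n)

Step : ∀ {n} → Generators n → Rel (Fin n) _
Step gs x y = Any (λ g → g x ≡ y) gs

Reach : ∀ {n} → Generators n → Rel (Fin n) _
Reach gs = Star (Step gs)

module _ {n : ℕ} (gs : Generators n) where

  -- a record rather than T (reachFrom …), so that k, x and y can be inferred
  record Within (k : ℕ) (x y : Fin n) : Set where
    constructor within
    field reached : T (reachFrom gs k x y)

  private
    step? : Fin n → Fin n → Bool
    step? z y = any (λ g → ⌊ g z ≟ᶠ y ⌋) gs

    step?⁻ : ∀ {z y} → T (step? z y) → Step gs z y
    step?⁻ {z} {y} h = Data.List.Relation.Unary.Any.map (λ {g} → toWitness {a? = g z ≟ᶠ y}) (any⁻ _ gs h)

    step?⁺ : ∀ {z y} → Step gs z y → T (step? z y)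
    step?⁺ {z} {y} s = any⁺ _ (Data.List.Relation.Unary.Any.map (λ {g} → fromWitness {a? = g z ≟ᶠ y}) s)

  within-refl : ∀ x → Within 0 x x
  within-refl x = within (fromWitness {a? = x ≟ᶠ x} refl)

  within-weaken : ∀ {k x y} → Within k x y → Within (suc k) x y
  within-weaken (within h) = within (Equivalence.from T-∨ (inj₁ h))

  within-snoc : ∀ {k x z y} → Within k x z → Step gs z y → Within (suc k) x y
  within-snoc {k} {x} {z} {y} (within h) s = within (Equivalence.from (T-∨ {reachFrom gs k x y}) (inj₂
    (any-allFin⁺ (λ w → reachFrom gs k x w ∧ step? w y) z (Equivalence.from T-∧ (h , step?⁺ s)))))

  within-suc⁻ : ∀ {k x y} → Within (suc k) x y → Within k x y ⊎ ∃ λ z → Within k x z × Step gs z y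
  within-suc⁻ {k} {x} {y} (within h) with Equivalence.to (T-∨ {reachFrom gs k x y}) h
  ... | inj₁ p = inj₁ (within p)
  ... | inj₂ p with any-allFin⁻ _ p
  ...   | z , q with Equivalence.to (T-∧ {reachFrom gs k x z}) q
  ...     | r , s = inj₂ (z , within r , step?⁻ s)

  within-mono : ∀ {i j x y} → i ≤ j → Within i x y → Within j x y
  within-mono {j = zero} z≤n h = h
  within-mono {j = suc j} i≤1+j h with m≤n⇒m<n∨m≡n i≤1+j
  ... | inj₁ i≤j = within-weaken (within-mono (≤-pred i≤j) h)
  ... | inj₂ refl = h

  within-sound : ∀ k {x y} → Within k x y → Reach gs x y
  within-sound zero {x} {y} (within h) with toWitness {a? = x ≟ᶠ y} h
  ... | refl = ε
  within-sound (suc k) h with within-suc⁻ h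
  ... | inj₁ p = within-sound k p
  ... | inj₂ (z , p , s) = within-sound k p ◅◅ (s ◅ ε)

  reach-within : ∀ {x y} → Reach gs x y → ∃ λ k → Within k x y
  reach-within {x} = go 0 (within-refl x)
    where
    go : ∀ {z y} k → Within k x z → Reach gs z y → ∃ λ k → Within k x y
    go k h ε = k , h
    go k h (s ◅ p) = go (suc k) (within-snoc h s) p

  FirstAt : Fin n → ℕ → Fin n → Set
  FirstAt x j y = Within j x y × (∀ {i} → i < j → ¬ Within i x y)

  firstAt-unique : ∀ {x y i j} → FirstAt x i y → FirstAt x j y → i ≡ j
  firstAt-unique {i = i} {j} (hi , mi) (hj , mj) with <-cmp i j
  ... | tri< i<j _ _ = ⊥-elim (mj i<j hi)
  ... | tri≈ _ i≡j _ = i≡j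
  ... | tri> _ _ j<i = ⊥-elim (mi j<i hj)

  firstAt-below : ∀ {x y i j} → FirstAt x j y → i ≤ j → ∃ λ z → FirstAt x i z
  firstAt-below {y = y} {j = j} first i≤j with m≤n⇒m<n∨m≡n i≤j
  ... | inj₂ refl = y , first
  firstAt-below {x} {j = suc j} (h , minimal) _ | inj₁ (s≤s i≤j) with within-suc⁻ h
  ... | inj₁ p = ⊥-elim (minimal ≤-refl p)
  ... | inj₂ (z , p , s) =
    firstAt-below (p , λ i<j r → minimal (s≤s i<j) (within-snoc r s)) i≤j

  -- points first reached at distinct distances are distinct, so by pigeonhole nothing is first reached after n steps
  within-stable : ∀ {k x y} → n ≤ k → Within (suc k) x y → Within k x y
  within-stable {k} {x} {y} n≤k h with T? (reachFrom gs k x y)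
  ... | yes p = within p
  ... | no ¬p = ⊥-elim (distinct (pigeonhole (s≤s (m≤n⇒m≤1+n n≤k)) atDistance))
    where
    first : FirstAt x (suc k) y
    first = h , λ i<1+k r → ¬p (Within.reached (within-mono (≤-pred i<1+k) r))
    atDistance : Fin (suc (suc k)) → Fin n
    atDistance i = proj₁ (firstAt-below first (toℕ≤pred[n] i))
    firstAtDistance : ∀ i → FirstAt x (toℕ i) (atDistance i)
    firstAtDistance i = proj₂ (firstAt-below first (toℕ≤pred[n] i))
    distinct : (∃ λ i → ∃ λ j → toℕ i < toℕ j × atDistance i ≡ atDistance j) → ⊥
    distinct (i , j , i<j , same) =
      <-irrefl (firstAt-unique (firstAtDistance i) (subst (FirstAt x (toℕ j)) (sym same) (firstAtDistance j))) i<j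

  within-bound : ∀ {k x y} → Within k x y → Within n x y
  within-bound {k} h with ≤-total k n
  ... | inj₁ k≤n = within-mono k≤n h
  ... | inj₂ n≤k = go k n≤k h
    where
    go : ∀ k {x y} → n ≤ k → Within k x y → Within n x y
    go k n≤k h with m≤n⇒m<n∨m≡n n≤k
    ... | inj₂ refl = h
    go (suc k) _ h | inj₁ (s≤s n≤k) = go k n≤k (within-stable n≤k h)

  sameOrbit-complete : ∀ {x y} → Reach gs x y → T (sameOrbit gs x y)
  sameOrbit-complete p = Within.reached (within-bound (proj₂ (reach-within p)))

  sameOrbit-sound : ∀ {x y} → T (sameOrbit gs x y) → Reach gs x y
  sameOrbit-sound h = within-sound n (within h)

data SplitView (a b : ℕ) : Fin (a + b) → Set where
  inl : ∀ i → SplitView a b (i ↑ˡ b)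
  inr : ∀ j → SplitView a b (a ↑ʳ j)

splitView : ∀ a b x → SplitView a b x
splitView zero    b x       = inr x
splitView (suc a) b zero    = inl zero
splitView (suc a) b (suc x) with splitView a b x
... | inl i = inl (suc i)
... | inr j = inr j

↑ˡ≢↑ʳ : ∀ {a b} (i : Fin a) (j : Fin b) → i ↑ˡ b ≢ a ↑ʳ j
↑ˡ≢↑ʳ {a} {b} i j e with trans (sym (splitAt-↑ˡ a i b)) (trans (cong (splitAt a) e) (splitAt-↑ʳ a b j))
... | ()

∑-tabulate : ∀ {n} (f : Fin n → ℕ) → sum (tabulate f) ≡ ∑ f
∑-tabulate {zero}  f = refl
∑-tabulate {suc n} f = cong (f zero +_) (∑-tabulate (f ∘ suc))

∑-mono : ∀ {n} {f g : Fin n → ℕ} → (∀ x → f x ≤ g x) → ∑ f ≤ ∑ g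
∑-mono {zero}  f≤g = z≤n
∑-mono {suc n} f≤g = +-mono-≤ (f≤g zero) (∑-mono (f≤g ∘ suc))

∑-strict : ∀ {n} {f g : Fin n → ℕ} z → (∀ x → f x ≤ g x) → f z < g z → ∑ f < ∑ g
∑-strict zero    f≤g fz<gz = +-mono-<-≤ fz<gz (∑-mono (f≤g ∘ suc))
∑-strict (suc z) f≤g fz<gz = +-mono-≤-< (f≤g zero) (∑-strict z (f≤g ∘ suc) fz<gz)

∑-bump : ∀ {n} {f g : Fin n → ℕ} z → (∀ x → x ≢ z → f x ≡ g x) → f z ≡ suc (g z) → ∑ f ≡ suc (∑ g)
∑-bump {suc n} zero f≡g fz≡1+gz =
  cong₂ _+_ fz≡1+gz (sum-cong-≗ λ x → f≡g (suc x) λ ())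
∑-bump {suc n} {f} {g} (suc z) f≡g fz≡1+gz = begin
  f zero + ∑ (f ∘ suc)       ≡⟨ cong₂ _+_ (f≡g zero λ ()) (∑-bump z (λ x x≢z → f≡g (suc x) (x≢z ∘ Data.Fin.Properties.suc-injective)) fz≡1+gz) ⟩
  g zero + suc (∑ (g ∘ suc)) ≡⟨ +-suc (g zero) _ ⟩
  suc (∑ g)                  ∎
  where open ≡-Reasoning

∑-++ : ∀ a b (f : Fin (a + b) → ℕ) → ∑ f ≡ ∑ (λ i → f (i ↑ˡ b)) + ∑ (λ j → f (a ↑ʳ j))
∑-++ zero    b f = refl
∑-++ (suc a) b f = trans (cong (f zero +_) (∑-++ a b (f ∘ suc))) (sym (+-assoc (f zero) _ _))

BRel : ℕ → Set
BRel n = Fin n → Fin n → Bool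

record IsEquivalenceᵇ {n} (r : BRel n) : Set where
  field
    r-refl  : ∀ x → T (r x x)
    r-sym   : ∀ x y → T (r x y) → T (r y x)
    r-trans : ∀ x y z → T (r x y) → T (r y z) → T (r x z)

T-extensional : ∀ {a b} → (T a → T b) → (T b → T a) → a ≡ b
T-extensional {false} {false} _ _ = refl
T-extensional {false} {true}  _ g = ⊥-elim (g _)
T-extensional {true}  {false} f _ = ⊥-elim (f _)
T-extensional {true}  {true}  _ _ = refl

indicator : Bool → ℕ
indicator b = if b then 1 else 0

indicator-mono : ∀ {a b} → (T a → T b) → indicator a ≤ indicator b
indicator-mono {false}         _ = z≤n
indicator-mono {true} {false}  f = ⊥-elim (f _)
indicator-mono {true} {true}   _ = ≤-refl

isLeast : ∀ {n} → BRel n → Fin n → Bool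
isLeast {n} r x = not (any (λ y → (toℕ y <ᵇ toℕ x) ∧ r x y) (allFin n))

-- unfolds to orbits gs when r is sameOrbit gs
classCount : ∀ {n} → BRel n → ℕ
classCount {n} r = sum (map (λ x → indicator (isLeast r x)) (allFin n))

Least : ∀ {n} → BRel n → Fin n → Set
Least r x = ∀ y → toℕ y < toℕ x → ¬ T (r x y)

module _ {n} (r : BRel n) where

  private
    Smaller : Fin n → Fin n → Bool
    Smaller x y = (toℕ y <ᵇ toℕ x) ∧ r x y

    smaller⁻ : ∀ {x y} → T (Smaller x y) → toℕ y < toℕ x × T (r x y)
    smaller⁻ {x} {y} h with Equivalence.to (T-∧ {toℕ y <ᵇ toℕ x}) h
    ... | y<x , rxy = <ᵇ⇒< _ _ y<x , rxy

  least-or-smaller : ∀ x → Least r x ⊎ ∃ λ y → toℕ y < toℕ x × T (r x y)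
  least-or-smaller x with any (Smaller x) (allFin n) in eq
  ... | true  = inj₂ (_ , smaller⁻ (proj₂ (any-allFin⁻ (Smaller x) (subst T (sym eq) _))))
  ... | false = inj₁ λ y y<x rxy →
    subst T eq (any-allFin⁺ (Smaller x) y (Equivalence.from T-∧ (<⇒<ᵇ y<x , rxy)))

  least⁺ : ∀ x → Least r x → T (isLeast r x)
  least⁺ x least with any (Smaller x) (allFin n) in eq
  ... | false = _
  ... | true  = let y , s = any-allFin⁻ (Smaller x) (subst T (sym eq) _)
                in least y (proj₁ (smaller⁻ s)) (proj₂ (smaller⁻ s))

  least⁻ : ∀ x → T (isLeast r x) → Least r x
  least⁻ x h y y<x rxy
    with any (Smaller x) (allFin n) | any-allFin⁺ (Smaller x) y (Equivalence.from T-∧ (<⇒<ᵇ y<x , rxy))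
  ... | true | _ = h

classCount-∑ : ∀ {n} (r : BRel n) → classCount r ≡ ∑ (λ x → indicator (isLeast r x))
classCount-∑ r = trans (cong sum (map-tabulate (λ x → x) (indicator ∘ isLeast r))) (∑-tabulate (indicator ∘ isLeast r))

isLeast-cong : ∀ {n n′} (r : BRel n) (s : BRel n′) x x′ →
  (Least r x → Least s x′) → (Least s x′ → Least r x) → isLeast r x ≡ isLeast s x′
isLeast-cong r s x x′ f g = T-extensional (least⁺ s x′ ∘ f ∘ least⁻ r x) (least⁺ r x ∘ g ∘ least⁻ s x′)

_⊆ᵇ_ : ∀ {n} → BRel n → BRel n → Set
r ⊆ᵇ s = ∀ x y → T (r x y) → T (s x y)

least-anti : ∀ {n} {r s : BRel n} {x} → r ⊆ᵇ s → Least s x → Least r x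
least-anti {x = x} r⊆s least y y<x rxy = least y y<x (r⊆s x y rxy)

classCount-cong : ∀ {n} {r s : BRel n} → r ⊆ᵇ s → s ⊆ᵇ r → classCount r ≡ classCount s
classCount-cong {r = r} {s} r⊆s s⊆r = begin
  classCount r                        ≡⟨ classCount-∑ r ⟩
  ∑ (λ x → indicator (isLeast r x))  ≡⟨ sum-cong-≗ (λ x → cong indicator (isLeast-cong r s x x (least-anti s⊆r) (least-anti r⊆s))) ⟩
  ∑ (λ x → indicator (isLeast s x))  ≡⟨ classCount-∑ s ⟨
  classCount s                        ∎
  where open ≡-Reasoning

classCount-antitone : ∀ {n} {r s : BRel n} → r ⊆ᵇ s → classCount s ≤ classCount r
classCount-antitone {r = r} {s} r⊆s =
  subst₂ _≤_ (sym (classCount-∑ s)) (sym (classCount-∑ r))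
    (∑-mono λ x → indicator-mono (least⁺ r x ∘ least-anti r⊆s ∘ least⁻ s x))

classCount-++ : ∀ {a b} (r : BRel (a + b)) (r₁ : BRel a) (r₂ : BRel b) →
  (∀ i j → T (r (i ↑ˡ b) (j ↑ˡ b)) ⇔ T (r₁ i j)) →
  (∀ i j → T (r (a ↑ʳ i) (a ↑ʳ j)) ⇔ T (r₂ i j)) →
  (∀ i j → ¬ T (r (a ↑ʳ j) (i ↑ˡ b))) →
  classCount r ≡ classCount r₁ + classCount r₂
classCount-++ {a} {b} r r₁ r₂ left right cross = begin
  classCount r
    ≡⟨ classCount-∑ r ⟩
  ∑ (λ x → indicator (isLeast r x))
    ≡⟨ ∑-++ a b _ ⟩
  ∑ (λ i → indicator (isLeast r (i ↑ˡ b))) + ∑ (λ j → indicator (isLeast r (a ↑ʳ j)))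
    ≡⟨ cong₂ _+_ (sum-cong-≗ λ i → cong indicator (isLeast-cong r r₁ _ i (leastˡ⁻ i) (leastˡ⁺ i)))
                 (sum-cong-≗ λ j → cong indicator (isLeast-cong r r₂ _ j (leastʳ⁻ j) (leastʳ⁺ j))) ⟩
  ∑ (λ i → indicator (isLeast r₁ i)) + ∑ (λ j → indicator (isLeast r₂ j))
    ≡⟨ cong₂ _+_ (classCount-∑ r₁) (classCount-∑ r₂) ⟨
  classCount r₁ + classCount r₂
    ∎
  where
  open ≡-Reasoning
  leastˡ⁺ : ∀ i → Least r₁ i → Least r (i ↑ˡ b)
  leastˡ⁺ i least y y<i rxy with splitView a b y
  ... | inl j = least j (subst₂ _<_ (toℕ-↑ˡ j b) (toℕ-↑ˡ i b) y<i) (Equivalence.to (left i j) rxy)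
  ... | inr j = <⇒≱ (subst₂ _<_ (toℕ-↑ʳ a j) (toℕ-↑ˡ i b) y<i) (≤-trans (<⇒≤ (toℕ<n i)) (m≤m+n a (toℕ j)))
  leastˡ⁻ : ∀ i → Least r (i ↑ˡ b) → Least r₁ i
  leastˡ⁻ i least j j<i r₁ij =
    least (j ↑ˡ b) (subst₂ _<_ (sym (toℕ-↑ˡ j b)) (sym (toℕ-↑ˡ i b)) j<i) (Equivalence.from (left i j) r₁ij)
  leastʳ⁺ : ∀ j → Least r₂ j → Least r (a ↑ʳ j)
  leastʳ⁺ j least y y<j rxy with splitView a b y
  ... | inl i = cross i j rxy
  ... | inr k = least k (+-cancelˡ-< a _ _ (subst₂ _<_ (toℕ-↑ʳ a k) (toℕ-↑ʳ a j) y<j)) (Equivalence.to (right j k) rxy)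
  leastʳ⁻ : ∀ j → Least r (a ↑ʳ j) → Least r₂ j
  leastʳ⁻ j least k k<j r₂jk =
    least (a ↑ʳ k) (subst₂ _<_ (sym (toℕ-↑ʳ a k)) (sym (toℕ-↑ʳ a j)) (+-monoʳ-< a k<j)) (Equivalence.from (right j k) r₂jk)

module ClassesOf {n} {r : BRel n} (E : IsEquivalenceᵇ r) where
  open IsEquivalenceᵇ E

  least-exists : ∀ x → ∃ λ m → T (r x m) × Least r m
  least-exists x = descend (suc (toℕ x)) x ≤-refl
    where
    descend : ∀ k x → toℕ x < k → ∃ λ m → T (r x m) × Least r m
    descend (suc k) x x<1+k with least-or-smaller r x
    ... | inj₁ least = x , r-refl x , least
    ... | inj₂ (y , y<x , rxy) with descend k y (<-≤-trans y<x (≤-pred x<1+k))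
    ...   | m , rym , least = m , r-trans x y m rxy rym , least

  least-unique : ∀ {a b} → Least r a → Least r b → T (r a b) → a ≡ b
  least-unique {a} {b} leastA leastB rab with <-cmp (toℕ a) (toℕ b)
  ... | tri< a<b _ _ = ⊥-elim (leastB a a<b (r-sym a b rab))
  ... | tri≈ _ a≡b _ = toℕ-injective a≡b
  ... | tri> _ _ b<a = ⊥-elim (leastA b b<a rab)

  least-≤ : ∀ {m y} → Least r m → T (r m y) → toℕ m ≤ toℕ y
  least-≤ {m} {y} least rmy = ≮⇒≥ λ y<m → least y y<m rmy

  -- r with the classes of p and q fused
  Joined : Fin n → Fin n → Fin n → Fin n → Set
  Joined p q x y = T (r x y) ⊎ (T (r x p) × T (r q y)) ⊎ (T (r x q) × T (r p y))

  joined-swap : ∀ {p q x y} → Joined p q x y → Joined q p x y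
  joined-swap (inj₁ rxy)       = inj₁ rxy
  joined-swap (inj₂ (inj₁ h)) = inj₂ (inj₂ h)
  joined-swap (inj₂ (inj₂ h)) = inj₂ (inj₁ h)

  joined-trans : ∀ {p q} x y z → Joined p q x y → Joined p q y z → Joined p q x z
  joined-trans {p} {q} x y z (inj₁ rxy) (inj₁ ryz) = inj₁ (r-trans x y z rxy ryz)
  joined-trans {p} {q} x y z (inj₁ rxy) (inj₂ (inj₁ (ryp , rqz))) = inj₂ (inj₁ (r-trans x y p rxy ryp , rqz))
  joined-trans {p} {q} x y z (inj₁ rxy) (inj₂ (inj₂ (ryq , rpz))) = inj₂ (inj₂ (r-trans x y q rxy ryq , rpz))
  joined-trans {p} {q} x y z (inj₂ (inj₁ (rxp , rqy))) (inj₁ ryz) = inj₂ (inj₁ (rxp , r-trans q y z rqy ryz))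
  joined-trans {p} {q} x y z (inj₂ (inj₁ (rxp , _))) (inj₂ (inj₁ (_ , rqz))) = inj₂ (inj₁ (rxp , rqz))
  joined-trans {p} {q} x y z (inj₂ (inj₁ (rxp , _))) (inj₂ (inj₂ (_ , rpz))) = inj₁ (r-trans x p z rxp rpz)
  joined-trans {p} {q} x y z (inj₂ (inj₂ (rxq , rpy))) (inj₁ ryz) = inj₂ (inj₂ (rxq , r-trans p y z rpy ryz))
  joined-trans {p} {q} x y z (inj₂ (inj₂ (rxq , _))) (inj₂ (inj₁ (_ , rqz))) = inj₁ (r-trans x q z rxq rqz)
  joined-trans {p} {q} x y z (inj₂ (inj₂ (rxq , _))) (inj₂ (inj₂ (_ , rpz))) = inj₂ (inj₂ (rxq , rpz))

  joined-⊆ : ∀ {s : BRel n} → r ⊆ᵇ s → IsEquivalenceᵇ s → ∀ {p q} → T (s p q) → ∀ x y → Joined p q x y → T (s x y)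
  joined-⊆ r⊆s S spq x y (inj₁ rxy) = r⊆s x y rxy
  joined-⊆ r⊆s S {p} {q} spq x y (inj₂ (inj₁ (rxp , rqy))) =
    s-trans x p y (r⊆s x p rxp) (s-trans p q y spq (r⊆s q y rqy))
    where open IsEquivalenceᵇ S renaming (r-trans to s-trans)
  joined-⊆ r⊆s S {p} {q} spq x y (inj₂ (inj₂ (rxq , rpy))) =
    s-trans x q y (r⊆s x q rxq) (s-trans q p y (s-sym p q spq) (r⊆s p y rpy))
    where open IsEquivalenceᵇ S renaming (r-trans to s-trans; r-sym to s-sym)

  private
    -- fusing makes the larger least point mp non-least and changes nothing else
    classCount-join-ordered : ∀ {s : BRel n} p q {mp mq} → (∀ x y → T (s x y) ⇔ Joined p q x y) →
      T (r p mp) → Least r mp → T (r q mq) → Least r mq → toℕ mq < toℕ mp → classCount r ≡ suc (classCount s)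
    classCount-join-ordered {s} p q {mp} {mq} s⇔ rpmp leastP rqmq leastQ mq<mp = begin
      classCount r                            ≡⟨ classCount-∑ r ⟩
      ∑ (λ x → indicator (isLeast r x))       ≡⟨ ∑-bump mp unchanged dropped ⟩
      suc (∑ (λ x → indicator (isLeast s x))) ≡⟨ cong suc (classCount-∑ s) ⟨
      suc (classCount s)                      ∎
      where
      open ≡-Reasoning
      r⊆s : r ⊆ᵇ s
      r⊆s x y rxy = Equivalence.from (s⇔ x y) (inj₁ rxy)
      dropped : indicator (isLeast r mp) ≡ suc (indicator (isLeast s mp))
      dropped with isLeast r mp | least⁺ r mp leastP | isLeast s mp in eq
      ... | true | _ | false = refl
      ... | true | _ | true  = ⊥-elim (least⁻ s mp (subst T (sym eq) _) mq mq<mp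
             (Equivalence.from (s⇔ mp mq) (inj₂ (inj₁ (r-sym p mp rpmp , rqmq)))))
      stays : ∀ x → x ≢ mp → Least r x → Least s x
      stays x x≢mp least y y<x sxy with Equivalence.to (s⇔ x y) sxy
      ... | inj₁ rxy = least y y<x rxy
      ... | inj₂ (inj₁ (rxp , _)) = x≢mp (least-unique least leastP (r-trans x p mp rxp rpmp))
      ... | inj₂ (inj₂ (rxq , rpy)) with least-unique least leastQ (r-trans x q mq rxq rqmq)
      ...   | refl = <⇒≱ (<-≤-trans mq<mp (least-≤ leastP (r-trans mp p y (r-sym p mp rpmp) rpy))) (<⇒≤ y<x)
      unchanged : ∀ x → x ≢ mp → indicator (isLeast r x) ≡ indicator (isLeast s x)
      unchanged x x≢mp = cong indicator (isLeast-cong r s x x (stays x x≢mp) (least-anti r⊆s))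

  classCount-join : ∀ {s : BRel n} p q → ¬ T (r p q) → (∀ x y → T (s x y) ⇔ Joined p q x y) →
    classCount r ≡ suc (classCount s)
  classCount-join p q ¬rpq s⇔ with least-exists p | least-exists q
  ... | mp , rpmp , leastP | mq , rqmq , leastQ with <-cmp (toℕ mp) (toℕ mq)
  ... | tri< mp<mq _ _ = classCount-join-ordered q p
          (λ x y → mk⇔ (joined-swap ∘ Equivalence.to (s⇔ x y)) (Equivalence.from (s⇔ x y) ∘ joined-swap))
          rqmq leastQ rpmp leastP mp<mq
  ... | tri≈ _ mp≡mq _ = ⊥-elim (¬rpq (r-trans p mp q rpmp
          (subst (λ m → T (r m q)) (sym (toℕ-injective mp≡mq)) (r-sym q mq rqmq))))
  ... | tri> _ _ mq<mp = classCount-join-ordered p q s⇔ rpmp leastP rqmq leastQ mq<mp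

  joinᵇ : Fin n → Fin n → BRel n
  joinᵇ p q x y = r x y ∨ ((r x p ∧ r q y) ∨ (r x q ∧ r p y))

  joinᵇ⇔ : ∀ p q x y → T (joinᵇ p q x y) ⇔ Joined p q x y
  joinᵇ⇔ p q x y = mk⇔ to from
    where
    to : T (joinᵇ p q x y) → Joined p q x y
    to h with Equivalence.to (T-∨ {r x y}) h
    ... | inj₁ rxy = inj₁ rxy
    ... | inj₂ h′ with Equivalence.to (T-∨ {r x p ∧ r q y}) h′
    ...   | inj₁ h″ = inj₂ (inj₁ (Equivalence.to T-∧ h″))
    ...   | inj₂ h″ = inj₂ (inj₂ (Equivalence.to T-∧ h″))
    from : Joined p q x y → T (joinᵇ p q x y)
    from (inj₁ rxy) = Equivalence.from T-∨ (inj₁ rxy)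
    from (inj₂ (inj₁ h)) = Equivalence.from (T-∨ {r x y}) (inj₂ (Equivalence.from T-∨ (inj₁ (Equivalence.from T-∧ h))))
    from (inj₂ (inj₂ h)) = Equivalence.from (T-∨ {r x y}) (inj₂ (Equivalence.from (T-∨ {r x p ∧ r q y}) (inj₂ (Equivalence.from T-∧ h))))

  classCount-join-≤ : ∀ {s : BRel n} p q → (∀ x y → T (s x y) → Joined p q x y) → classCount r ≤ suc (classCount s)
  classCount-join-≤ {s} p q s⊆joined with T? (r p q)
  ... | yes rpq = ≤-trans (classCount-antitone λ x y sxy → joined-⊆ (λ _ _ rxy → rxy) E rpq x y (s⊆joined x y sxy)) (n≤1+n _)
  ... | no ¬rpq = begin
    classCount r                 ≡⟨ classCount-join p q ¬rpq (joinᵇ⇔ p q) ⟩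
    suc (classCount (joinᵇ p q)) ≤⟨ s≤s (classCount-antitone λ x y sxy → Equivalence.from (joinᵇ⇔ p q x y) (s⊆joined x y sxy)) ⟩
    suc (classCount s)           ∎
    where open ≤-Reasoning

step-sym : ∀ {n} {gs : Generators n} → All Involution gs → ∀ {x y} → Step gs x y → Step gs y x
step-sym (inv ∷ _)    (here refl) = here (inv _)
step-sym (_ ∷ invs) (there s)   = there (step-sym invs s)

sameOrbit-equivalence : ∀ {n} {gs : Generators n} → All Involution gs → IsEquivalenceᵇ (sameOrbit gs)
sameOrbit-equivalence {gs = gs} invs = record
  { r-refl  = λ x → sameOrbit-complete gs ε
  ; r-sym   = λ x y h → sameOrbit-complete gs (reverse (step-sym invs) (sameOrbit-sound gs h))
  ; r-trans = λ x y z h k → sameOrbit-complete gs (sameOrbit-sound gs h ◅◅ sameOrbit-sound gs k)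
  }

sameOrbit-step : ∀ {n} {gs : Generators n} {x y} → Step gs x y → T (sameOrbit gs x y)
sameOrbit-step {gs = gs} s = sameOrbit-complete gs (return s)

sameOrbit-fold : ∀ {n} {gs : Generators n} (P : Fin n → Fin n → Set) →
  (∀ x → P x x) → (∀ x y z → P x y → P y z → P x z) → (∀ {x y} → Step gs x y → P x y) →
  ∀ {x y} → T (sameOrbit gs x y) → P x y
sameOrbit-fold {gs = gs} P P-refl P-trans step⇒P h =
  fold P (λ s p → P-trans _ _ _ (step⇒P s) p) (P-refl _) (sameOrbit-sound gs h)

sameOrbit-mono : ∀ {n} {gs gs′ : Generators n} → (∀ {x y} → Step gs x y → Reach gs′ x y) →
  ∀ {x y} → T (sameOrbit gs x y) → T (sameOrbit gs′ x y)
sameOrbit-mono {gs = gs} {gs′} step⇒reach h =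
  sameOrbit-complete gs′ (kleisliStar (λ x → x) step⇒reach (sameOrbit-sound gs h))

orbits-cong : ∀ {n} {gs gs′ : Generators n} →
  (∀ {x y} → Step gs x y → Reach gs′ x y) → (∀ {x y} → Step gs′ x y → Reach gs x y) → orbits gs ≡ orbits gs′
orbits-cong {gs = gs} {gs′} to from =
  classCount-cong {r = sameOrbit gs} {s = sameOrbit gs′} (λ _ _ → sameOrbit-mono to) (λ _ _ → sameOrbit-mono from)

Intertwines : ∀ {a N} → (Fin a → Fin N) → Generators a → Generators N → Set
Intertwines e = Pointwise λ g G → ∀ x → G (e x) ≡ e (g x)

module _ {a N} {e : Fin a → Fin N} where

  step-image : ∀ {gs GS} → Intertwines e gs GS → ∀ {x y} → Step gs x y → Step GS (e x) (e y)
  step-image (comm ∷ _)  (here refl) = here (comm _)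
  step-image (_ ∷ comms) (there s)   = there (step-image comms s)

  step-preimage : ∀ {gs GS} → Intertwines e gs GS → ∀ {x y} → Step GS (e x) y → ∃ λ y′ → y ≡ e y′ × Step gs x y′
  step-preimage (comm ∷ _)  (here refl) = _ , comm _ , here refl
  step-preimage (_ ∷ comms) (there s) with step-preimage comms s
  ... | y′ , refl , s′ = y′ , refl , there s′

  reach-preimage : ∀ {gs GS} → Intertwines e gs GS → ∀ {x y} → Reach GS (e x) y → ∃ λ y′ → y ≡ e y′ × Reach gs x y′
  reach-preimage comms ε = _ , refl , ε
  reach-preimage comms (s ◅ p) with step-preimage comms s
  ... | _ , refl , s′ with reach-preimage comms p
  ...   | y′ , refl , p′ = y′ , refl , s′ ◅ p′

  sameOrbit-image⇔ : ∀ {gs GS} → Intertwines e gs GS → (∀ {x y} → e x ≡ e y → x ≡ y) →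
    ∀ x y → T (sameOrbit GS (e x) (e y)) ⇔ T (sameOrbit gs x y)
  sameOrbit-image⇔ {gs} {GS} comms e-inj x y = mk⇔ to from
    where
    to : T (sameOrbit GS (e x) (e y)) → T (sameOrbit gs x y)
    to h with reach-preimage comms (sameOrbit-sound GS h)
    ... | y′ , ey≡ey′ , p rewrite e-inj ey≡ey′ = sameOrbit-complete gs p
    from : T (sameOrbit gs x y) → T (sameOrbit GS (e x) (e y))
    from h = sameOrbit-complete GS (kleisliStar e (return ∘ step-image comms) (sameOrbit-sound gs h))

orbits-pointwise : ∀ {n} {gs gs′ : Generators n} → Intertwines (λ x → x) gs gs′ → orbits gs′ ≡ orbits gs
orbits-pointwise {gs = gs} {gs′} same = classCount-cong {r = sameOrbit gs′} {s = sameOrbit gs}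
  (λ x y → Equivalence.to (sameOrbit-image⇔ same (λ e → e) x y))
  (λ x y → Equivalence.from (sameOrbit-image⇔ same (λ e → e) x y))

orbits-++ : ∀ {a b} {gs₁ : Generators a} {gs₂ : Generators b} {GS : Generators (a + b)} →
  Intertwines (_↑ˡ b) gs₁ GS → Intertwines (a ↑ʳ_) gs₂ GS → orbits GS ≡ orbits gs₁ + orbits gs₂
orbits-++ {a} {b} {GS = GS} left right = classCount-++ (sameOrbit GS) _ _
  (sameOrbit-image⇔ left (↑ˡ-injective b _ _))
  (sameOrbit-image⇔ right (↑ʳ-injective a _ _))
  λ i j h → let _ , eq , _ = reach-preimage right (sameOrbit-sound GS h) in ↑ˡ≢↑ʳ i _ eq

⌊⌋-yes : ∀ {A : Set} (a? : Dec A) → A → ⌊ a? ⌋ ≡ true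
⌊⌋-yes (yes _) _ = refl
⌊⌋-yes (no ¬a) a = ⊥-elim (¬a a)

⌊⌋-no : ∀ {A : Set} (a? : Dec A) → ¬ A → ⌊ a? ⌋ ≡ false
⌊⌋-no (yes a) ¬a = ⊥-elim (¬a a)
⌊⌋-no (no _)  _  = refl

module Reglue {n} {h : Fin n → Fin n} (h-inv : Involution h) (h-fpf : FixedPointFree h)
              {x y b d : Fin n} (hx≡b : h x ≡ b) (hy≡d : h y ≡ d) (x≢y : x ≢ y) (b≢y : b ≢ y) where

  h′ : Fin n → Fin n
  h′ = reglue h x b y d

  hb≡x : h b ≡ x
  hb≡x = trans (cong h (sym hx≡b)) (h-inv x)

  hd≡y : h d ≡ y
  hd≡y = trans (cong h (sym hy≡d)) (h-inv y)

  x≢b : x ≢ b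
  x≢b x≡b = h-fpf x (trans hx≡b (sym x≡b))

  y≢d : y ≢ d
  y≢d y≡d = h-fpf y (trans hy≡d (sym y≡d))

  x≢d : x ≢ d
  x≢d x≡d = b≢y (trans (sym hx≡b) (trans (cong h x≡d) hd≡y))

  b≢d : b ≢ d
  b≢d b≡d = x≢y (trans (sym hb≡x) (trans (cong h b≡d) hd≡y))

  h′-cases : (Q : Fin n → Fin n → Set) → Q x y → Q y x → Q b d → Q d b →
    (∀ z → z ≢ x → z ≢ y → z ≢ b → z ≢ d → Q z (h z)) → ∀ z → Q z (h′ z)
  h′-cases Q qx qy qb qd qz z with z ≟ᶠ x
  ... | yes refl = qx
  ... | no z≢x with z ≟ᶠ y
  ...   | yes refl = qy
  ...   | no z≢y with z ≟ᶠ b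
  ...     | yes refl = qb
  ...     | no z≢b with z ≟ᶠ d
  ...       | yes refl = qd
  ...       | no z≢d = qz z z≢x z≢y z≢b z≢d

  h′x≡y : h′ x ≡ y
  h′x≡y rewrite ⌊⌋-yes (x ≟ᶠ x) refl = refl

  h′y≡x : h′ y ≡ x
  h′y≡x rewrite ⌊⌋-no (y ≟ᶠ x) (x≢y ∘ sym) | ⌊⌋-yes (y ≟ᶠ y) refl = refl

  h′b≡d : h′ b ≡ d
  h′b≡d rewrite ⌊⌋-no (b ≟ᶠ x) (x≢b ∘ sym) | ⌊⌋-no (b ≟ᶠ y) b≢y | ⌊⌋-yes (b ≟ᶠ b) refl = refl

  h′d≡b : h′ d ≡ b
  h′d≡b rewrite ⌊⌋-no (d ≟ᶠ x) (x≢d ∘ sym) | ⌊⌋-no (d ≟ᶠ y) (y≢d ∘ sym)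
              | ⌊⌋-no (d ≟ᶠ b) (b≢d ∘ sym) | ⌊⌋-yes (d ≟ᶠ d) refl = refl

  h′-other : ∀ z → z ≢ x → z ≢ y → z ≢ b → z ≢ d → h′ z ≡ h z
  h′-other z z≢x z≢y z≢b z≢d rewrite ⌊⌋-no (z ≟ᶠ x) z≢x | ⌊⌋-no (z ≟ᶠ y) z≢y
                                    | ⌊⌋-no (z ≟ᶠ b) z≢b | ⌊⌋-no (z ≟ᶠ d) z≢d = refl

  h-cases : (Q : Fin n → Fin n → Set) → Q x b → Q y d → Q b x → Q d y → (∀ z → Q z (h′ z)) → ∀ z → Q z (h z)
  h-cases Q qx qy qb qd qz = h′-cases (λ z _ → Q z (h z))
    (subst (Q x) (sym hx≡b) qx) (subst (Q y) (sym hy≡d) qy) (subst (Q b) (sym hb≡x) qb) (subst (Q d) (sym hd≡y) qd)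
    λ z z≢x z≢y z≢b z≢d → subst (Q z) (h′-other z z≢x z≢y z≢b z≢d) (qz z)

  h′-involution : Involution h′
  h′-involution = h′-cases (λ z w → h′ w ≡ z) h′y≡x h′x≡y h′d≡b h′b≡d λ z z≢x z≢y z≢b z≢d →
    h′-cases (λ w v → h w ≡ z → v ≡ z)
      (λ hx≡z → ⊥-elim (z≢b (trans (sym hx≡z) hx≡b)))
      (λ hy≡z → ⊥-elim (z≢d (trans (sym hy≡z) hy≡d)))
      (λ hb≡z → ⊥-elim (z≢x (trans (sym hb≡z) hb≡x)))
      (λ hd≡z → ⊥-elim (z≢y (trans (sym hd≡z) hd≡y)))
      (λ _ _ _ _ _ hw≡z → hw≡z) (h z) (h-inv z)

  h′-fpf : FixedPointFree h′
  h′-fpf = h′-cases (λ z w → w ≢ z) (x≢y ∘ sym) x≢y (b≢d ∘ sym) b≢d (λ z _ _ _ _ → h-fpf z)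

data Replace {n} (g g′ : Fin n → Fin n) : Generators n → Generators n → Set where
  at-head : ∀ {gs} → Replace g g′ (g ∷ gs) (g′ ∷ gs)
  skip    : ∀ {f gs gs′} → Replace g g′ gs gs′ → Replace g g′ (f ∷ gs) (f ∷ gs′)

module _ {n} {g g′ : Fin n → Fin n} where

  replace-sym : ∀ {gs gs′} → Replace g g′ gs gs′ → Replace g′ g gs′ gs
  replace-sym at-head    = at-head
  replace-sym (skip rep) = skip (replace-sym rep)

  replaced-step : ∀ {gs gs′} → Replace g g′ gs gs′ → ∀ z → Step gs′ z (g′ z)
  replaced-step at-head    z = here refl
  replaced-step (skip rep) z = there (replaced-step rep z)

  replace-step : ∀ {gs gs′} → Replace g g′ gs gs′ → ∀ {z w} → Step gs′ z w → Step gs z w ⊎ g′ z ≡ w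
  replace-step at-head    (here e)  = inj₂ e
  replace-step at-head    (there s) = inj₁ (there s)
  replace-step (skip rep) (here e)  = inj₁ (here e)
  replace-step (skip rep) (there s) with replace-step rep s
  ... | inj₁ s′ = inj₁ (there s′)
  ... | inj₂ e  = inj₂ e

  replace-involutive : ∀ {gs gs′} → Replace g g′ gs gs′ → Involution g′ → All Involution gs → All Involution gs′
  replace-involutive at-head    inv′ (_ ∷ invs)   = inv′ ∷ invs
  replace-involutive (skip rep) inv′ (inv ∷ invs) = inv ∷ replace-involutive rep inv′ invs

  replace-orbit-fold : ∀ {gs gs′} → Replace g g′ gs gs′ → (P : Fin n → Fin n → Set) →
    (∀ z → P z z) → (∀ z w v → P z w → P w v → P z v) → (∀ {z w} → Step gs z w → P z w) → (∀ z → P z (g′ z)) →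
    ∀ {z w} → T (sameOrbit gs′ z w) → P z w
  replace-orbit-fold rep P P-refl P-trans step⇒P g′⇒P = sameOrbit-fold P P-refl P-trans step′⇒P
    where
    step′⇒P : ∀ {z w} → Step _ z w → P z w
    step′⇒P s with replace-step rep s
    ... | inj₁ s′   = step⇒P s′
    ... | inj₂ refl = g′⇒P _

-- Regluing trades the h-pairs {x, b}, {y, d} for {x, y}, {b, d}: the new orbits refine the old ones
-- with the classes of x and y fused, and the old orbits refine the new ones with those of x and b fused.
module Surgery {n} {h : Fin n → Fin n} (h-inv : Involution h) (h-fpf : FixedPointFree h)
               {x y b d : Fin n} (hx≡b : h x ≡ b) (hy≡d : h y ≡ d) (x≢y : x ≢ y) (b≢y : b ≢ y)
               {gsO gsN : Generators n} (rep : Replace h (reglue h x b y d) gsO gsN) (invO : All Involution gsO) where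

  open Reglue h-inv h-fpf hx≡b hy≡d x≢y b≢y public

  old new : BRel n
  old = sameOrbit gsO
  new = sameOrbit gsN

  Old : IsEquivalenceᵇ old
  Old = sameOrbit-equivalence invO

  New : IsEquivalenceᵇ new
  New = sameOrbit-equivalence (replace-involutive rep h′-involution invO)

  module O = IsEquivalenceᵇ Old
  module N = IsEquivalenceᵇ New
  module OldClasses = ClassesOf Old
  module NewClasses = ClassesOf New

  old-step : ∀ {z w} → Step gsO z w → T (old z w)
  old-step = sameOrbit-step

  new-step : ∀ {z w} → Step gsN z w → T (new z w)
  new-step = sameOrbit-step

  old-h : ∀ z → T (old z (h z))
  old-h z = old-step (replaced-step (replace-sym rep) z)

  new-h′ : ∀ z → T (new z (h′ z))
  new-h′ z = new-step (replaced-step rep z)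

  old-xb : T (old x b)
  old-xb = subst (T ∘ old x) hx≡b (old-h x)

  old-yd : T (old y d)
  old-yd = subst (T ∘ old y) hy≡d (old-h y)

  new-xy : T (new x y)
  new-xy = subst (T ∘ new x) h′x≡y (new-h′ x)

  new-bd : T (new b d)
  new-bd = subst (T ∘ new b) h′b≡d (new-h′ b)

  new⊆old : T (old x y) → new ⊆ᵇ old
  new⊆old old-xy z w = replace-orbit-fold rep (λ z w → T (old z w)) O.r-refl O.r-trans sameOrbit-step
    (h′-cases (λ z w → T (old z w)) old-xy (O.r-sym x y old-xy)
      (O.r-trans b x d (O.r-sym x b old-xb) (O.r-trans x y d old-xy old-yd))
      (O.r-trans d y b (O.r-sym y d old-yd) (O.r-trans y x b (O.r-sym x y old-xy) old-xb))
      λ z _ _ _ _ → old-h z)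

  old⊆new : T (new x b) → old ⊆ᵇ new
  old⊆new new-xb z w = replace-orbit-fold (replace-sym rep) (λ z w → T (new z w)) N.r-refl N.r-trans sameOrbit-step
    (h-cases (λ z w → T (new z w)) new-xb new-yd (N.r-sym x b new-xb) (N.r-sym y d new-yd) new-h′)
    where
    new-yd : T (new y d)
    new-yd = N.r-trans y x d (N.r-sym x y new-xy) (N.r-trans x b d new-xb new-bd)

  old⊆joined : ∀ z w → T (old z w) → NewClasses.Joined x b z w
  old⊆joined z w = replace-orbit-fold (replace-sym rep) (NewClasses.Joined x b)
    (λ z → inj₁ (N.r-refl z)) NewClasses.joined-trans (λ s → inj₁ (sameOrbit-step s))
    (h-cases (NewClasses.Joined x b)
      (inj₂ (inj₁ (N.r-refl x , N.r-refl b)))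
      (inj₂ (inj₁ (N.r-sym x y new-xy , new-bd)))
      (inj₂ (inj₂ (N.r-refl b , N.r-refl x)))
      (inj₂ (inj₂ (N.r-sym b d new-bd , new-xy)))
      λ z → inj₁ (new-h′ z))

  new⊆joined : ∀ z w → T (new z w) → OldClasses.Joined x y z w
  new⊆joined z w = replace-orbit-fold rep (OldClasses.Joined x y)
    (λ z → inj₁ (O.r-refl z)) OldClasses.joined-trans (λ s → inj₁ (sameOrbit-step s))
    (h′-cases (OldClasses.Joined x y)
      (inj₂ (inj₁ (O.r-refl x , O.r-refl y)))
      (inj₂ (inj₂ (O.r-refl y , O.r-refl x)))
      (inj₂ (inj₁ (O.r-sym x b old-xb , old-yd)))
      (inj₂ (inj₂ (O.r-sym y d old-yd , old-xb)))
      λ z _ _ _ _ → inj₁ (old-h z))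

  orbits-split : T (old x y) → ¬ T (new x b) → orbits gsN ≡ suc (orbits gsO)
  orbits-split old-xy ¬new-xb = NewClasses.classCount-join x b ¬new-xb λ z w →
    mk⇔ (old⊆joined z w) (NewClasses.joined-⊆ (new⊆old old-xy) Old old-xb z w)

  orbits-same : T (old x y) → T (new x b) → orbits gsN ≡ orbits gsO
  orbits-same old-xy new-xb = classCount-cong (new⊆old old-xy) (old⊆new new-xb)

  orbits-merge : ¬ T (old x y) → T (new x b) → orbits gsO ≡ suc (orbits gsN)
  orbits-merge ¬old-xy new-xb = OldClasses.classCount-join x y ¬old-xy λ z w →
    mk⇔ (new⊆joined z w) (OldClasses.joined-⊆ (old⊆new new-xb) New new-xy z w)

  orbits-≤ : orbits gsO ≤ suc (orbits gsN)
  orbits-≤ = OldClasses.classCount-join-≤ x y new⊆joined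

least-witness : ∀ {P : ℕ → Set} → Decidable P → ∀ {m} → P m → ∃ λ k → P k × ∀ {j} → j < k → ¬ P j
least-witness {P} P? {m} pm = search (suc m) (m , ≤-refl , pm)
  where
  search : ∀ v → (∃ λ k → k < v × P k) → ∃ λ k → P k × ∀ {j} → j < k → ¬ P j
  search (suc v) (k , k<1+v , pk) with anyUpTo? P? v
  ... | yes below = search v below
  ... | no none   = k , pk , λ j<k pj → none (_ , <-≤-trans j<k (≤-pred k<1+v) , pj)

even-or-odd : ∀ i → ∃ λ j → i ≡ j + j ⊎ i ≡ j + suc j
even-or-odd zero = 0 , inj₁ refl
even-or-odd (suc i) with even-or-odd i
... | j , inj₁ refl = j , inj₂ (sym (+-suc j j))
... | j , inj₂ refl = suc j , inj₁ refl

module AlternatingWalk {n} {g h : Fin n → Fin n} (g-inv : Involution g) (h-inv : Involution h)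
                       (g-fpf : FixedPointFree g) (h-fpf : FixedPointFree h) (x : Fin n) where

  walk : ℕ → Fin n
  walk zero    = x
  walk (suc i) = h (g (walk i))

  walk-back : ∀ i → g (h (walk (suc i))) ≡ walk i
  walk-back i = trans (cong g (h-inv _)) (g-inv _)

  walk-shift : ∀ i k → walk i ≡ walk (i + k) → x ≡ walk k
  walk-shift zero    k same = same
  walk-shift (suc i) k same = walk-shift i k
    (trans (sym (walk-back i)) (trans (cong (g ∘ h) same) (walk-back (i + k))))

  walk-returns : ∃ λ p → walk (suc p) ≡ x
  walk-returns with pigeonhole (n<1+n n) (walk ∘ toℕ)
  ... | i , j , i<j , same = toℕ j ∸ suc (toℕ i) , sym (walk-shift (toℕ i) _ (trans same (cong walk j≡i+k)))
    where
    j≡i+k : toℕ j ≡ toℕ i + suc (toℕ j ∸ suc (toℕ i))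
    j≡i+k = sym (trans (+-suc (toℕ i) _) (m+[n∸m]≡n i<j))

  unwalk : ℕ → Fin n → Fin n
  unwalk zero    z = z
  unwalk (suc k) z = unwalk k (g (h z))

  unwalk-suc : ∀ k z → unwalk (suc k) z ≡ g (h (unwalk k z))
  unwalk-suc zero    z = refl
  unwalk-suc (suc k) z = unwalk-suc k (g (h z))

  g-walk : ∀ i → g (walk i) ≡ unwalk i (g x)
  g-walk zero    = refl
  g-walk (suc i) = trans (cong (g ∘ h) (g-walk i)) (sym (unwalk-suc i (g x)))

  unwalk-walk : ∀ j k → unwalk j (walk (j + k)) ≡ walk k
  unwalk-walk zero    k = refl
  unwalk-walk (suc j) k = trans (cong (unwalk j) (walk-back (j + k))) (unwalk-walk j k)

  -- g (walk (2j)) fixing x would make g fix walk j, and g (walk (2j+1)) fixing x would make h fix g (walk j)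
  g-walk≢x : ∀ i → g (walk i) ≢ x
  g-walk≢x i gwalk≡x with even-or-odd i
  ... | j , inj₁ refl = g-fpf (walk j) (begin
    g (walk j)               ≡⟨ g-walk j ⟩
    unwalk j (g x)           ≡⟨ cong (unwalk j) (trans (cong g (sym gwalk≡x)) (g-inv _)) ⟩
    unwalk j (walk (j + j))  ≡⟨ unwalk-walk j j ⟩
    walk j                   ∎)
    where open ≡-Reasoning
  ... | j , inj₂ refl = h-fpf (g (walk j)) (sym (begin
    g (walk j)                   ≡⟨ g-walk j ⟩
    unwalk j (g x)               ≡⟨ cong (unwalk j) (trans (cong g (sym gwalk≡x)) (g-inv _)) ⟩
    unwalk j (walk (j + suc j))  ≡⟨ unwalk-walk j (suc j) ⟩
    h (g (walk j))               ∎))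
    where open ≡-Reasoning

  reach-walk : ∀ i → Reach (h ∷ g ∷ []) x (walk i)
  reach-walk zero    = ε
  reach-walk (suc i) = reach-walk i ◅◅ (there (here refl) ◅ here refl ◅ ε)

  path-to-h : (S : Fin n → Fin n → Set) →
    (∀ z → Reach (h ∷ g ∷ []) x z → S z (g z)) →
    (∀ z → Reach (h ∷ g ∷ []) x z → z ≢ x → z ≢ h x → S z (h z)) →
    Star S x (h x)
  path-to-h S g-step h-step with least-witness (λ p → walk (suc p) ≟ᶠ x) {proj₁ walk-returns} (proj₂ walk-returns)
  ... | p , returns , first = subst (Star S x) gwalk≡hx (go p ≤-refl ◅◅ return (g-step _ (reach-walk p)))
    where
    gwalk≡hx : g (walk p) ≡ h x
    gwalk≡hx = trans (sym (h-inv _)) (cong h returns)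
    go : ∀ i → i ≤ p → Star S x (walk i)
    go zero    _   = ε
    go (suc i) i<p = go i (<⇒≤ i<p) ◅◅ (g-step _ (reach-walk i) ◅
      h-step _ (reach-walk i ◅◅ return (there (here refl))) (g-walk≢x i)
               (λ gwalk≡hx → first i<p (trans (cong h gwalk≡hx) (h-inv x))) ◅ ε)

swap-closed : ∀ {n} {gs : Generators n} {x y} → All (λ g → g x ≡ y × g y ≡ x) gs →
  ∀ {z} → T (sameOrbit gs x z) → z ≡ x ⊎ z ≡ y
swap-closed {gs = gs} {x} {y} swaps h = go (inj₁ refl) (sameOrbit-sound gs h)
  where
  step : ∀ {u w} → u ≡ x ⊎ u ≡ y → Step gs u w → w ≡ x ⊎ w ≡ y
  step u∈ s with lookupAny swaps s | u∈
  ... | (gx≡y , _) , gu≡w | inj₁ refl = inj₂ (trans (sym gu≡w) gx≡y)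
  ... | (_ , gy≡x) , gu≡w | inj₂ refl = inj₁ (trans (sym gu≡w) gy≡x)
  go : ∀ {u w} → u ≡ x ⊎ u ≡ y → Reach gs u w → w ≡ x ⊎ w ≡ y
  go u∈ ε       = u∈
  go u∈ (s ◅ p) = go (step u∈ s) p

orbits-all≗ : ∀ {n} {f g : Fin n → Fin n} {gs : Generators n} → All (λ g → ∀ z → g z ≡ f z) (g ∷ gs) →
  orbits (g ∷ gs) ≡ orbits (f ∷ [])
orbits-all≗ {f = f} all≗f@(g≗f ∷ _) = orbits-cong to from
  where
  to : ∀ {z w} → Step _ z w → Reach (f ∷ []) z w
  to s with lookupAny all≗f s
  ... | g≗f , gz≡w = return (here (trans (sym (g≗f _)) gz≡w))
  from : ∀ {z w} → Step (f ∷ []) z w → Reach _ z w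
  from (here refl) = return (here (g≗f _))

mismatch : ∀ {n} → Fin n → Fin n → ℕ
mismatch a b = if ⌊ a ≟ᶠ b ⌋ then 0 else 1

mismatch-≡ : ∀ {n} {a b : Fin n} → a ≡ b → mismatch a b ≡ 0
mismatch-≡ {a = a} {b} a≡b rewrite ⌊⌋-yes (a ≟ᶠ b) a≡b = refl

mismatch-≢ : ∀ {n} {a b : Fin n} → a ≢ b → mismatch a b ≡ 1
mismatch-≢ {a = a} {b} a≢b rewrite ⌊⌋-no (a ≟ᶠ b) a≢b = refl

mismatch-≤1 : ∀ {n} (a b : Fin n) → mismatch a b ≤ 1
mismatch-≤1 a b with ⌊ a ≟ᶠ b ⌋
... | true  = z≤n
... | false = ≤-refl

module Realign {n} {α h : Fin n → Fin n} (α-inv : Involution α) (α-fpf : FixedPointFree α)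
               (h-inv : Involution h) (h-fpf : FixedPointFree h) (x : Fin n) (misaligned : h x ≢ α x) where

  x≢αx : x ≢ α x
  x≢αx x≡αx = α-fpf x (sym x≡αx)

  open Reglue h-inv h-fpf {x} {α x} {h x} {h (α x)} refl refl x≢αx misaligned public

  mismatch-≤ : ∀ z → mismatch (h′ z) (α z) ≤ mismatch (h z) (α z)
  mismatch-≤ = h′-cases (λ z w → mismatch w (α z) ≤ mismatch (h z) (α z))
    (≤-trans (≤-reflexive (mismatch-≡ refl)) z≤n)
    (≤-trans (≤-reflexive (mismatch-≡ (sym (α-inv x)))) z≤n)
    (≤-trans (mismatch-≤1 _ _) (≤-reflexive (sym (mismatch-≢ λ hb≡αb →
      misaligned (trans (sym (α-inv (h x))) (cong α (trans (sym hb≡αb) hb≡x)))))))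
    (≤-trans (mismatch-≤1 _ _) (≤-reflexive (sym (mismatch-≢ λ hd≡αd →
      x≢d (trans (sym (α-inv x)) (trans (cong α (trans (sym hd≡y) hd≡αd)) (α-inv _)))))))
    (λ _ _ _ _ _ → ≤-refl)

  mismatches-decrease : ∑ (λ z → mismatch (h′ z) (α z)) < ∑ (λ z → mismatch (h z) (α z))
  mismatches-decrease = ∑-strict x mismatch-≤
    (subst₂ _<_ (sym (mismatch-≡ h′x≡y)) (sym (mismatch-≢ misaligned)) (s≤s z≤n))

record Involutive (H : RawHypermap) : Set where
  field
    α-inv : Involution (α H)
    β-inv : Involution (β H)
    γ-inv : Involution (γ H)
    α-fpf : FixedPointFree (α H)
    β-fpf : FixedPointFree (β H)
    γ-fpf : FixedPointFree (γ H)

GenusBound : RawHypermap → Set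
GenusBound H = vH H + eH H + fH H ≤ 2 * kH H + dH H

misalignment : RawHypermap → ℕ
misalignment H = ∑ (λ z → mismatch (β H z) (α H z)) + ∑ (λ z → mismatch (γ H z) (α H z))

private
  bound-one-split : ∀ {v v′ e f f′ k k′ d} → v′ ≡ suc v → k′ ≡ k → f ≤ suc f′ →
    v′ + e + f′ ≤ 2 * k′ + d → v + e + f ≤ 2 * k + d
  bound-one-split {v} {e = e} {f} {f′} {k} {d = d} refl refl f≤1+f′ bound′ = begin
    v + e + f      ≤⟨ +-monoʳ-≤ (v + e) f≤1+f′ ⟩
    v + e + suc f′ ≡⟨ +-suc (v + e) f′ ⟩
    suc v + e + f′ ≤⟨ bound′ ⟩
    2 * k + d      ∎
    where open ≤-Reasoning

  two-more : ∀ k d → 2 * suc k + d ≡ 2 + (2 * k + d)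
  two-more = solve-∀

  bound-vfk-split : ∀ {v v′ e f f′ k k′ d} → v′ ≡ suc v → k′ ≡ suc k → f′ ≡ suc f →
    v′ + e + f′ ≤ 2 * k′ + d → v + e + f ≤ 2 * k + d
  bound-vfk-split {v} {e = e} {f} {k = k} {d = d} refl refl refl bound′ = +-cancelˡ-≤ 2 _ _ (begin
    2 + (v + e + f)     ≡⟨ rearrange v e f ⟩
    suc v + e + suc f   ≤⟨ bound′ ⟩
    2 * suc k + d       ≡⟨ two-more k d ⟩
    2 + (2 * k + d)     ∎)
    where
    open ≤-Reasoning
    rearrange : ∀ v e f → 2 + (v + e + f) ≡ suc v + e + suc f
    rearrange = solve-∀

  bound-efk-split : ∀ {v e e′ f f′ k k′ d} → e′ ≡ suc e → k′ ≡ suc k → f′ ≡ suc f →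
    v + e′ + f′ ≤ 2 * k′ + d → v + e + f ≤ 2 * k + d
  bound-efk-split {v} {e} {f = f} {k = k} {d = d} refl refl refl bound′ = +-cancelˡ-≤ 2 _ _ (begin
    2 + (v + e + f)     ≡⟨ rearrange v e f ⟩
    v + suc e + suc f   ≤⟨ bound′ ⟩
    2 * suc k + d       ≡⟨ two-more k d ⟩
    2 + (2 * k + d)     ∎)
    where
    open ≤-Reasoning
    rearrange : ∀ v e f → 2 + (v + e + f) ≡ v + suc e + suc f
    rearrange = solve-∀

genusBound-aligned : ∀ H → (∀ z → β H z ≡ α H z) → (∀ z → γ H z ≡ α H z) → GenusBound H
genusBound-aligned H β≗α γ≗α
  rewrite orbits-all≗ ((λ _ → refl) ∷ β≗α ∷ [])
        | orbits-all≗ ((λ _ → refl) ∷ γ≗α ∷ [])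
        | orbits-all≗ (β≗α ∷ γ≗α ∷ [])
        | orbits-all≗ ((λ _ → refl) ∷ β≗α ∷ γ≗α ∷ []) = ≤-reflexive (count (orbits (α H ∷ [])) (iso H))
  where
  count : ∀ D i → D + i + D + (D + i) ≡ 2 * (D + i) + D
  count = solve-∀

module BetaMove (H : RawHypermap) (I : Involutive H) (x : Fin (n H)) (misaligned : β H x ≢ α H x) where
  open Involutive I
  open Realign α-inv α-fpf β-inv β-fpf x misaligned

  H′ : RawHypermap
  H′ = record H { β = h′ }

  involutive : Involutive H′
  involutive = record
    { α-inv = α-inv ; β-inv = h′-involution ; γ-inv = γ-inv
    ; α-fpf = α-fpf ; β-fpf = h′-fpf       ; γ-fpf = γ-fpf }

  decreases : misalignment H′ < misalignment H
  decreases = +-monoˡ-< _ mismatches-decrease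

  private
    module V = Surgery β-inv β-fpf refl refl x≢αx misaligned {gsO = α H ∷ β H ∷ []} (skip at-head) (α-inv ∷ β-inv ∷ [])
    module F = Surgery β-inv β-fpf refl refl x≢αx misaligned {gsO = β H ∷ γ H ∷ []} at-head (β-inv ∷ γ-inv ∷ [])
    module K = Surgery β-inv β-fpf refl refl x≢αx misaligned {gsO = α H ∷ β H ∷ γ H ∷ []} (skip at-head) (α-inv ∷ β-inv ∷ γ-inv ∷ [])

    vertex-split : vH H′ ≡ suc (vH H)
    vertex-split = cong (_+ iso H) (V.orbits-split (V.old-step (here refl)) λ new-xb →
      [ x≢b ∘ sym , misaligned ]′ (swap-closed ((refl , α-inv x) ∷ (h′x≡y , h′y≡x) ∷ []) new-xb))

    -- after regluing, x and β x are still joined by a γ/β walk unless α x lies on the old face of x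
    βx-still-joined : ¬ T (F.old x (α H x)) → T (K.new x (β H x))
    βx-still-joined ¬old-xy = sameOrbit-complete _ (AlternatingWalk.path-to-h γ-inv β-inv γ-fpf β-fpf x (Step _)
      (λ _ _ → there (there (here refl)))
      λ z reach z≢x z≢b → there (here (h′-other z z≢x (z≢y reach) z≢b (z≢d reach))))
      where
      z≢y : ∀ {z} → Reach (β H ∷ γ H ∷ []) x z → z ≢ α H x
      z≢y reach refl = ¬old-xy (sameOrbit-complete _ reach)
      z≢d : ∀ {z} → Reach (β H ∷ γ H ∷ []) x z → z ≢ β H (α H x)
      z≢d reach refl = ¬old-xy (sameOrbit-complete _ (reach ◅◅ return (here (β-inv _))))

  genusBound-reglued : GenusBound H′ → GenusBound H
  genusBound-reglued bound′ with T? (K.new x (β H x))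
  ... | yes new-xb = bound-one-split vertex-split (cong (_+ iso H) (K.orbits-same (K.old-step (here refl)) new-xb))
                       (+-monoˡ-≤ (iso H) F.orbits-≤) bound′
  ... | no ¬new-xb with T? (F.old x (α H x))
  ...   | yes old-xy = bound-vfk-split vertex-split
          (cong (_+ iso H) (K.orbits-split (K.old-step (here refl)) ¬new-xb))
          (cong (_+ iso H) (F.orbits-split old-xy (¬new-xb ∘ sameOrbit-mono {gs = h′ ∷ γ H ∷ []} (return ∘ there))))
          bound′
  ...   | no ¬old-xy = ⊥-elim (¬new-xb (βx-still-joined ¬old-xy))

module GammaMove (H : RawHypermap) (I : Involutive H) (β≗α : ∀ z → β H z ≡ α H z)
                 (x : Fin (n H)) (misaligned : γ H x ≢ α H x) where
  open Involutive I
  open Realign α-inv α-fpf γ-inv γ-fpf x misaligned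

  H′ : RawHypermap
  H′ = record H { γ = h′ }

  involutive : Involutive H′
  involutive = record
    { α-inv = α-inv ; β-inv = β-inv ; γ-inv = h′-involution
    ; α-fpf = α-fpf ; β-fpf = β-fpf ; γ-fpf = h′-fpf }

  decreases : misalignment H′ < misalignment H
  decreases = +-monoʳ-< (∑ λ z → mismatch (β H z) (α H z)) mismatches-decrease

  private
    module E = Surgery γ-inv γ-fpf refl refl x≢αx misaligned {gsO = α H ∷ γ H ∷ []} (skip at-head) (α-inv ∷ γ-inv ∷ [])
    module F = Surgery γ-inv γ-fpf refl refl x≢αx misaligned {gsO = β H ∷ γ H ∷ []} (skip at-head) (β-inv ∷ γ-inv ∷ [])
    module K = Surgery γ-inv γ-fpf refl refl x≢αx misaligned {gsO = α H ∷ β H ∷ γ H ∷ []} (skip (skip at-head)) (α-inv ∷ β-inv ∷ γ-inv ∷ [])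

    α-swaps : α H x ≡ α H x × α H (α H x) ≡ x
    α-swaps = refl , α-inv x

    β-swaps : β H x ≡ α H x × β H (α H x) ≡ x
    β-swaps = β≗α x , trans (β≗α _) (α-inv x)

    h′-swaps : h′ x ≡ α H x × h′ (α H x) ≡ x
    h′-swaps = h′x≡y , h′y≡x

    -- {x, α x} is a whole orbit after regluing, and γ x lies outside it
    outside : ∀ {gs : Generators (n H)} → All (λ g → g x ≡ α H x × g (α H x) ≡ x) gs → ¬ T (sameOrbit gs x (γ H x))
    outside swaps = [ x≢b ∘ sym , misaligned ]′ ∘ swap-closed swaps

  genusBound-reglued : GenusBound H′ → GenusBound H
  genusBound-reglued = bound-efk-split {v = vH H}
    (E.orbits-split (E.old-step (here refl)) (outside (α-swaps ∷ h′-swaps ∷ [])))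
    (cong (_+ iso H) (K.orbits-split (K.old-step (here refl)) (outside (α-swaps ∷ β-swaps ∷ h′-swaps ∷ []))))
    (cong (_+ iso H) (F.orbits-split (F.old-step (here (β≗α x))) (outside (β-swaps ∷ h′-swaps ∷ []))))

genusBound-below : ∀ N H → Involutive H → misalignment H < N → GenusBound H
genusBound-below (suc N) H I m<1+N with all? (λ z → β H z ≟ᶠ α H z)
... | no ¬β≗α = let x , misaligned = ¬∀⟶∃¬ _ _ (λ z → β H z ≟ᶠ α H z) ¬β≗α; open BetaMove H I x misaligned in
  genusBound-reglued (genusBound-below N H′ involutive (<-≤-trans decreases (≤-pred m<1+N)))
... | yes β≗α with all? (λ z → γ H z ≟ᶠ α H z)
...   | no ¬γ≗α = let x , misaligned = ¬∀⟶∃¬ _ _ (λ z → γ H z ≟ᶠ α H z) ¬γ≗α; open GammaMove H I β≗α x misaligned in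
  genusBound-reglued (genusBound-below N H′ involutive (<-≤-trans decreases (≤-pred m<1+N)))
...   | yes γ≗α = genusBound-aligned H β≗α γ≗α

genusBound : ∀ H → Involutive H → GenusBound H
genusBound H I = genusBound-below (suc (misalignment H)) H I ≤-refl

count : ∀ {A : Set} → (A → ℕ) → List A → Poly
count g xs k = length (filter (λ x → g x ≟ k) xs)

count-++ : ∀ {A : Set} (g : A → ℕ) xs ys k → count g (xs ++ ys) k ≡ count g xs k + count g ys k
count-++ g xs ys k = trans (cong length (filter-++ (λ x → g x ≟ k) xs ys)) (length-++ (filter _ xs))

count-map : ∀ {A B : Set} (g : B → ℕ) (f : A → B) xs k → count g (map f xs) k ≡ count (g ∘ f) xs k
count-map g f []       k = refl
count-map g f (x ∷ xs) k with does (g (f x) ≟ k)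
... | true  = cong suc (count-map g f xs k)
... | false = count-map g f xs k

count-≐ : ∀ {A : Set} {g g′ : A → ℕ} {k k′} → (∀ x → g x ≡ k → g′ x ≡ k′) → (∀ x → g′ x ≡ k′ → g x ≡ k) →
  ∀ xs → count g xs k ≡ count g′ xs k′
count-≐ to from xs = cong length (filter-≐ _ _ ((λ {x} → to x) , (λ {x} → from x)) xs)

count-cong : ∀ {A : Set} {g g′ : A → ℕ} → (∀ x → g x ≡ g′ x) → ∀ xs k → count g xs k ≡ count g′ xs k
count-cong g≗g′ xs k = count-≐ (λ x gx≡k → trans (sym (g≗g′ x)) gx≡k) (λ x g′x≡k → trans (g≗g′ x) g′x≡k) xs

count-none : ∀ {A : Set} {g : A → ℕ} {k} → (∀ x → g x ≢ k) → ∀ xs → count g xs k ≡ 0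
count-none g≢k xs = cong length (filter-none _ (universal g≢k xs))

count-allSubsets-suc : ∀ a (g : Subset (suc a) → ℕ) k →
  count g (allSubsets (suc a)) k ≡ count (g ∘ (true ∷_)) (allSubsets a) k + count (g ∘ (false ∷_)) (allSubsets a) k
count-allSubsets-suc a g k = trans (count-++ g (map (true ∷_) (allSubsets a)) _ k)
  (cong₂ _+_ (count-map g (true ∷_) (allSubsets a) k) (count-map g (false ∷_) (allSubsets a) k))

-- Kronecker delta, by recursion so that δ (suc c) (suc i) = δ c i holds definitionally
δ : ℕ → ℕ → ℕ
δ zero    zero    = 1
δ zero    (suc _) = 0
δ (suc _) zero    = 0
δ (suc c) (suc i) = δ c i

δ-refl : ∀ c → δ c c ≡ 1
δ-refl zero    = refl
δ-refl (suc c) = δ-refl c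

δ-≢ : ∀ {c i} → c ≢ i → δ c i ≡ 0
δ-≢ {zero}  {zero}  c≢i = ⊥-elim (c≢i refl)
δ-≢ {zero}  {suc i} c≢i = refl
δ-≢ {suc c} {zero}  c≢i = refl
δ-≢ {suc c} {suc i} c≢i = δ-≢ (c≢i ∘ cong suc)

count-singleton : ∀ {A : Set} (g : A → ℕ) x k → count g (x ∷ []) k ≡ δ (g x) k
count-singleton g x k with g x ≟ k
... | yes gx≡k = trans (cong length (filter-accept (λ y → g y ≟ k) gx≡k)) (sym (subst (λ j → δ (g x) j ≡ 1) gx≡k (δ-refl (g x))))
... | no  gx≢k = trans (cong length (filter-reject (λ y → g y ≟ k) gx≢k)) (sym (δ-≢ gx≢k))

∑-δ : ∀ m c (F : ℕ → ℕ) → ∑ {m} (λ i → δ c (toℕ i) * F (toℕ i)) ≡ (if c <ᵇ m then F c else 0)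
∑-δ zero    c       F = refl
∑-δ (suc m) zero    F = trans (cong₂ _+_ (+-identityʳ (F 0)) (sum-replicate-zero m)) (+-identityʳ (F 0))
∑-δ (suc m) (suc c) F = ∑-δ m c (F ∘ suc)

∑-applyUpTo : ∀ m (f : ℕ → ℕ) (g : ℕ → ℕ) → sum (map f (applyUpTo g m)) ≡ ∑ {m} (λ i → f (g (toℕ i)))
∑-applyUpTo zero    f g = refl
∑-applyUpTo (suc m) f g = cong (f (g 0) +_) (∑-applyUpTo m f (g ∘ suc))

⊛-∑ : ∀ p q k → (p ⊛ q) k ≡ ∑ {suc k} (λ i → p (toℕ i) * q (k ∸ toℕ i))
⊛-∑ p q k = ∑-applyUpTo (suc k) (λ i → p i * q (k ∸ i)) (λ i → i)

⊛-congˡ : ∀ {p p′} → (∀ i → p i ≡ p′ i) → ∀ q k → (p ⊛ q) k ≡ (p′ ⊛ q) k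
⊛-congˡ p≗p′ q k = cong sum (map-cong (λ i → cong (_* q (k ∸ i)) (p≗p′ i)) (upTo (suc k)))

⊛-distribʳ-+ : ∀ p p′ q k → ((λ i → p i + p′ i) ⊛ q) k ≡ (p ⊛ q) k + (p′ ⊛ q) k
⊛-distribʳ-+ p p′ q k = begin
  ((λ i → p i + p′ i) ⊛ q) k
    ≡⟨ ⊛-∑ (λ i → p i + p′ i) q k ⟩
  ∑ {suc k} (λ i → (p (toℕ i) + p′ (toℕ i)) * q (k ∸ toℕ i))
    ≡⟨ sum-cong-≗ {suc k} (λ i → *-distribʳ-+ (q (k ∸ toℕ i)) (p (toℕ i)) (p′ (toℕ i))) ⟩
  ∑ {suc k} (λ i → p (toℕ i) * q (k ∸ toℕ i) + p′ (toℕ i) * q (k ∸ toℕ i))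
    ≡⟨ ∑-distrib-+ {suc k} (λ i → p (toℕ i) * q (k ∸ toℕ i)) (λ i → p′ (toℕ i) * q (k ∸ toℕ i)) ⟩
  ∑ {suc k} (λ i → p (toℕ i) * q (k ∸ toℕ i)) + ∑ {suc k} (λ i → p′ (toℕ i) * q (k ∸ toℕ i))
    ≡⟨ cong₂ _+_ (⊛-∑ p q k) (⊛-∑ p′ q k) ⟨
  (p ⊛ q) k + (p′ ⊛ q) k
    ∎
  where open ≡-Reasoning

δ-⊛ : ∀ c q k → ((δ c) ⊛ q) k ≡ (if c <ᵇ suc k then q (k ∸ c) else 0)
δ-⊛ c q k = trans (⊛-∑ (δ c) q k) (∑-δ (suc k) c (λ i → q (k ∸ i)))

count-shift : ∀ {A : Set} c (g : A → ℕ) xs k →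
  count (λ x → c + g x) xs k ≡ (if c <ᵇ suc k then count g xs (k ∸ c) else 0)
count-shift c g xs k with c ≤? k | c <ᵇ suc k in c<ᵇ1+k
... | yes c≤k | true  = count-≐ (λ x c+gx≡k → trans (sym (m+n∸m≡n c (g x))) (cong (_∸ c) c+gx≡k))
                              (λ x gx≡k∸c → trans (cong (c +_) gx≡k∸c) (m+[n∸m]≡n c≤k)) xs
... | yes c≤k | false = ⊥-elim (subst T c<ᵇ1+k (<⇒<ᵇ (s≤s c≤k)))
... | no  c≰k | false = count-none (λ x c+gx≡k → c≰k (subst (c ≤_) c+gx≡k (m≤m+n c (g x)))) xs
... | no  c≰k | true  = ⊥-elim (c≰k (≤-pred (<ᵇ⇒< c (suc k) (subst T (sym c<ᵇ1+k) _))))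

count-allSubsets-⊛ : ∀ a b (g : Subset (a + b) → ℕ) (g₁ : Subset a → ℕ) (g₂ : Subset b → ℕ) →
  (∀ A₁ A₂ → g (A₁ ++ᵥ A₂) ≡ g₁ A₁ + g₂ A₂) →
  ∀ k → count g (allSubsets (a + b)) k ≡ (count g₁ (allSubsets a) ⊛ count g₂ (allSubsets b)) k
count-allSubsets-⊛ zero b g g₁ g₂ additive k = begin
  count g (allSubsets b) k
    ≡⟨ count-≐ (λ A gA≡k → trans (sym (additive [] A)) gA≡k) (λ A g₁+g₂≡k → trans (additive [] A) g₁+g₂≡k) (allSubsets b) ⟩
  count (λ A → g₁ [] + g₂ A) (allSubsets b) k
    ≡⟨ count-shift (g₁ []) g₂ (allSubsets b) k ⟩
  (if g₁ [] <ᵇ suc k then count g₂ (allSubsets b) (k ∸ g₁ []) else 0)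
    ≡⟨ δ-⊛ (g₁ []) (count g₂ (allSubsets b)) k ⟨
  (δ (g₁ []) ⊛ count g₂ (allSubsets b)) k
    ≡⟨ ⊛-congˡ (λ i → sym (count-singleton g₁ [] i)) (count g₂ (allSubsets b)) k ⟩
  (count g₁ (allSubsets zero) ⊛ count g₂ (allSubsets b)) k
    ∎
  where open ≡-Reasoning
count-allSubsets-⊛ (suc a) b g g₁ g₂ additive k = begin
  count g (allSubsets (suc a + b)) k
    ≡⟨ count-allSubsets-suc (a + b) g k ⟩
  count (g ∘ (true ∷_)) (allSubsets (a + b)) k + count (g ∘ (false ∷_)) (allSubsets (a + b)) k
    ≡⟨ cong₂ _+_ (count-allSubsets-⊛ a b _ _ g₂ (additive ∘ (true ∷_)) k)
                 (count-allSubsets-⊛ a b _ _ g₂ (additive ∘ (false ∷_)) k) ⟩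
  (count (g₁ ∘ (true ∷_)) (allSubsets a) ⊛ q) k + (count (g₁ ∘ (false ∷_)) (allSubsets a) ⊛ q) k
    ≡⟨ ⊛-distribʳ-+ (count (g₁ ∘ (true ∷_)) (allSubsets a)) (count (g₁ ∘ (false ∷_)) (allSubsets a)) q k ⟨
  ((λ i → count (g₁ ∘ (true ∷_)) (allSubsets a) i + count (g₁ ∘ (false ∷_)) (allSubsets a) i) ⊛ q) k
    ≡⟨ ⊛-congˡ (λ i → sym (count-allSubsets-suc a g₁ i)) q k ⟩
  (count g₁ (allSubsets (suc a)) ⊛ q) k
    ∎
  where
  open ≡-Reasoning
  q : Poly
  q = count g₂ (allSubsets b)

⊕-↑ˡ : ∀ {a b c d} (f : Fin a → Fin c) (g : Fin b → Fin d) i → (f ⊕ g) (i ↑ˡ b) ≡ f i ↑ˡ d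
⊕-↑ˡ {a} {b} f g i rewrite splitAt-↑ˡ a i b = refl

⊕-↑ʳ : ∀ {a b c d} (f : Fin a → Fin c) (g : Fin b → Fin d) j → (f ⊕ g) (a ↑ʳ j) ≡ c ↑ʳ g j
⊕-↑ʳ {a} {b} f g j rewrite splitAt-↑ʳ a b j = refl

⊕-involution : ∀ {a b} {f : Fin a → Fin a} {g : Fin b → Fin b} → Involution f → Involution g → Involution (f ⊕ g)
⊕-involution {a} {b} {f} {g} f-inv g-inv z with splitView a b z
... | inl i = trans (cong (f ⊕ g) (⊕-↑ˡ f g i)) (trans (⊕-↑ˡ f g (f i)) (cong (_↑ˡ b) (f-inv i)))
... | inr j = trans (cong (f ⊕ g) (⊕-↑ʳ f g j)) (trans (⊕-↑ʳ f g (g j)) (cong (a ↑ʳ_) (g-inv j)))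

⊕-fpf : ∀ {a b} {f : Fin a → Fin a} {g : Fin b → Fin b} → FixedPointFree f → FixedPointFree g → FixedPointFree (f ⊕ g)
⊕-fpf {a} {b} {f} {g} f-fpf g-fpf z with splitView a b z
... | inl i = f-fpf i ∘ ↑ˡ-injective b _ _ ∘ trans (sym (⊕-↑ˡ f g i))
... | inr j = g-fpf j ∘ ↑ʳ-injective a _ _ ∘ trans (sym (⊕-↑ʳ f g j))

⊕-intertwinesˡ : ∀ {a b} (fs : Generators a) (gs : Generators b) → length fs ≡ length gs →
  Intertwines (_↑ˡ b) fs (zipWith _⊕_ fs gs)
⊕-intertwinesˡ []       []       _   = []
⊕-intertwinesˡ (f ∷ fs) (g ∷ gs) len = ⊕-↑ˡ f g ∷ ⊕-intertwinesˡ fs gs (suc-injective len)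

⊕-intertwinesʳ : ∀ {a b} (fs : Generators a) (gs : Generators b) → length fs ≡ length gs →
  Intertwines (a ↑ʳ_) gs (zipWith _⊕_ fs gs)
⊕-intertwinesʳ []       []       _   = []
⊕-intertwinesʳ (f ∷ fs) (g ∷ gs) len = ⊕-↑ʳ f g ∷ ⊕-intertwinesʳ fs gs (suc-injective len)

orbits-⊕ : ∀ {a b} (fs : Generators a) (gs : Generators b) → length fs ≡ length gs →
  orbits (zipWith _⊕_ fs gs) ≡ orbits fs + orbits gs
orbits-⊕ fs gs len = orbits-++ (⊕-intertwinesˡ fs gs len) (⊕-intertwinesʳ fs gs len)

∸-+-distrib : ∀ {a₁ a₂ b₁ b₂} → b₁ ≤ a₁ → b₂ ≤ a₂ → (a₁ + a₂) ∸ (b₁ + b₂) ≡ (a₁ ∸ b₁) + (a₂ ∸ b₂)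
∸-+-distrib {a₁} {a₂} {b₁} {b₂} b₁≤a₁ b₂≤a₂ = begin
  (a₁ + a₂) ∸ (b₁ + b₂)   ≡⟨ ∸-+-assoc (a₁ + a₂) b₁ b₂ ⟨
  (a₁ + a₂) ∸ b₁ ∸ b₂     ≡⟨ cong (_∸ b₂) (+-∸-comm a₂ b₁≤a₁) ⟩
  (a₁ ∸ b₁) + a₂ ∸ b₂     ≡⟨ +-∸-assoc (a₁ ∸ b₁) b₂≤a₂ ⟩
  (a₁ ∸ b₁) + (a₂ ∸ b₂)   ∎
  where open ≡-Reasoning

eulerGenus-rawUnion : ∀ H₁ H₂ → GenusBound H₁ → GenusBound H₂ →
  eulerGenus (rawUnion H₁ H₂) ≡ eulerGenus H₁ + eulerGenus H₂
eulerGenus-rawUnion H₁ H₂ bound₁ bound₂ = begin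
  eulerGenus (rawUnion H₁ H₂)
    ≡⟨ cong₂ _∸_ (cong₂ (λ k d → 2 * k + d) k≡ d≡) (cong₂ _+_ (cong₂ _+_ v≡ e≡) f≡) ⟩
  (2 * (kH H₁ + kH H₂) + (dH H₁ + dH H₂)) ∸ ((vH H₁ + vH H₂) + (eH H₁ + eH H₂) + (fH H₁ + fH H₂))
    ≡⟨ cong₂ _∸_ (regroup₂ (kH H₁) (kH H₂) (dH H₁) (dH H₂)) (regroup₃ (vH H₁) (vH H₂) (eH H₁) (eH H₂) (fH H₁) (fH H₂)) ⟩
  ((2 * kH H₁ + dH H₁) + (2 * kH H₂ + dH H₂)) ∸ ((vH H₁ + eH H₁ + fH H₁) + (vH H₂ + eH H₂ + fH H₂))
    ≡⟨ ∸-+-distrib bound₁ bound₂ ⟩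
  eulerGenus H₁ + eulerGenus H₂
    ∎
  where
  open ≡-Reasoning
  with-iso : ∀ (fs : Generators (n H₁)) (gs : Generators (n H₂)) → length fs ≡ length gs →
    orbits (zipWith _⊕_ fs gs) + (iso H₁ + iso H₂) ≡ (orbits fs + iso H₁) + (orbits gs + iso H₂)
  with-iso fs gs len = trans (cong (_+ _) (orbits-⊕ fs gs len)) (interchange (orbits fs) (orbits gs) (iso H₁) (iso H₂))
  k≡ : kH (rawUnion H₁ H₂) ≡ kH H₁ + kH H₂
  k≡ = with-iso (α H₁ ∷ β H₁ ∷ γ H₁ ∷ []) (α H₂ ∷ β H₂ ∷ γ H₂ ∷ []) refl
  v≡ : vH (rawUnion H₁ H₂) ≡ vH H₁ + vH H₂
  v≡ = with-iso (α H₁ ∷ β H₁ ∷ []) (α H₂ ∷ β H₂ ∷ []) refl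
  f≡ : fH (rawUnion H₁ H₂) ≡ fH H₁ + fH H₂
  f≡ = with-iso (β H₁ ∷ γ H₁ ∷ []) (β H₂ ∷ γ H₂ ∷ []) refl
  e≡ : eH (rawUnion H₁ H₂) ≡ eH H₁ + eH H₂
  e≡ = orbits-⊕ (α H₁ ∷ γ H₁ ∷ []) (α H₂ ∷ γ H₂ ∷ []) refl
  d≡ : dH (rawUnion H₁ H₂) ≡ dH H₁ + dH H₂
  d≡ = orbits-⊕ (α H₁ ∷ []) (α H₂ ∷ []) refl
  regroup₂ : ∀ k₁ k₂ d₁ d₂ → 2 * (k₁ + k₂) + (d₁ + d₂) ≡ (2 * k₁ + d₁) + (2 * k₂ + d₂)
  regroup₂ = solve-∀
  regroup₃ : ∀ v₁ v₂ e₁ e₂ f₁ f₂ → (v₁ + v₂) + (e₁ + e₂) + (f₁ + f₂) ≡ (v₁ + e₁ + f₁) + (v₂ + e₂ + f₂)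
  regroup₃ = solve-∀

eulerGenus-cong : ∀ H {α′ β′ γ′ : Fin (n H) → Fin (n H)} →
  (∀ z → α′ z ≡ α H z) → (∀ z → β′ z ≡ β H z) → (∀ z → γ′ z ≡ γ H z) →
  eulerGenus (record H { α = α′ ; β = β′ ; γ = γ′ }) ≡ eulerGenus H
eulerGenus-cong H α≗ β≗ γ≗ = cong₂ _∸_
  (cong₂ (λ k d → 2 * k + d) (cong (_+ iso H) (orbits-pointwise (α≗ ∷ β≗ ∷ γ≗ ∷ []))) (orbits-pointwise (α≗ ∷ [])))
  (cong₂ _+_ (cong₂ _+_ (cong (_+ iso H) (orbits-pointwise (α≗ ∷ β≗ ∷ []))) (orbits-pointwise (α≗ ∷ γ≗ ∷ [])))
             (cong (_+ iso H) (orbits-pointwise (β≗ ∷ γ≗ ∷ []))))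

cong₃-if : ∀ {A : Set} {b b′ : Bool} {x x′ y y′ : A} → b ≡ b′ → x ≡ x′ → y ≡ y′ →
  (if b then x else y) ≡ (if b′ then x′ else y′)
cong₃-if refl refl refl = refl

record WellFormed (H : RawHypermap) : Set where
  field
    involutive : Involutive H
    edge-α : ∀ x → edge H (α H x) ≡ edge H x
    edge-γ : ∀ x → edge H (γ H x) ≡ edge H x
  open Involutive involutive public

hypermap-wellFormed : (H : Hypermap) → WellFormed (carrier H)
hypermap-wellFormed H = record
  { involutive = record { α-inv = α-inv ; β-inv = β-inv ; γ-inv = γ-inv ; α-fpf = α-fpf ; β-fpf = β-fpf ; γ-fpf = γ-fpf }
  ; edge-α = edge-α
  ; edge-γ = edge-γ
  }
  where open IsHypermap (valid H)

-- the edge-respecting choice between two involutions made by partialDual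
select : ∀ {n m} → Subset m → (Fin n → Fin m) → (Fin n → Fin n) → (Fin n → Fin n) → Fin n → Fin n
select A edge f g x = if lookup A (edge x) then f x else g x

select-involution : ∀ {n m} (A : Subset m) {edge : Fin n → Fin m} {f g : Fin n → Fin n} →
  (∀ x → edge (f x) ≡ edge x) → (∀ x → edge (g x) ≡ edge x) → Involution f → Involution g →
  Involution (select A edge f g)
select-involution A {edge} {f} {g} edge-f edge-g f-inv g-inv x with lookup A (edge x) in eq
... | true  rewrite edge-f x | eq = f-inv x
... | false rewrite edge-g x | eq = g-inv x

select-fpf : ∀ {n m} (A : Subset m) {edge : Fin n → Fin m} {f g : Fin n → Fin n} →
  FixedPointFree f → FixedPointFree g → FixedPointFree (select A edge f g)
select-fpf A {edge} f-fpf g-fpf x with lookup A (edge x)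
... | true  = f-fpf x
... | false = g-fpf x

partialDual-involutive : ∀ {H} → WellFormed H → ∀ A → Involutive (partialDual H A)
partialDual-involutive wf A = record
  { α-inv = select-involution A edge-γ edge-α γ-inv α-inv
  ; β-inv = β-inv
  ; γ-inv = select-involution A edge-α edge-γ α-inv γ-inv
  ; α-fpf = select-fpf A γ-fpf α-fpf
  ; β-fpf = β-fpf
  ; γ-fpf = select-fpf A α-fpf γ-fpf
  }
  where open WellFormed wf

select-⊕ : ∀ {a b c d} (A₁ : Subset c) (A₂ : Subset d) (e₁ : Fin a → Fin c) (e₂ : Fin b → Fin d)
  (f₁ g₁ : Fin a → Fin a) (f₂ g₂ : Fin b → Fin b) →
  ∀ z → (select A₁ e₁ f₁ g₁ ⊕ select A₂ e₂ f₂ g₂) z ≡ select (A₁ ++ᵥ A₂) (e₁ ⊕ e₂) (f₁ ⊕ f₂) (g₁ ⊕ g₂) z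
select-⊕ {a} {b} {c} {d} A₁ A₂ e₁ e₂ f₁ g₁ f₂ g₂ z with splitView a b z
... | inl i = begin
  (select A₁ e₁ f₁ g₁ ⊕ select A₂ e₂ f₂ g₂) (i ↑ˡ b)                 ≡⟨ ⊕-↑ˡ (select A₁ e₁ f₁ g₁) (select A₂ e₂ f₂ g₂) i ⟩
  (if lookup A₁ (e₁ i) then f₁ i else g₁ i) ↑ˡ b                        ≡⟨ if-float (_↑ˡ b) (lookup A₁ (e₁ i)) ⟩
  (if lookup A₁ (e₁ i) then f₁ i ↑ˡ b else g₁ i ↑ˡ b)                   ≡⟨ cong₃-if (lookup-++ˡ A₁ A₂ (e₁ i)) (⊕-↑ˡ f₁ f₂ i) (⊕-↑ˡ g₁ g₂ i) ⟨
  (if lookup (A₁ ++ᵥ A₂) (e₁ i ↑ˡ d) then (f₁ ⊕ f₂) (i ↑ˡ b) else (g₁ ⊕ g₂) (i ↑ˡ b))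
                                                                         ≡⟨ cong (λ e → if lookup (A₁ ++ᵥ A₂) e then _ else _) (⊕-↑ˡ e₁ e₂ i) ⟨
  select (A₁ ++ᵥ A₂) (e₁ ⊕ e₂) (f₁ ⊕ f₂) (g₁ ⊕ g₂) (i ↑ˡ b)             ∎
  where open ≡-Reasoning
... | inr j = begin
  (select A₁ e₁ f₁ g₁ ⊕ select A₂ e₂ f₂ g₂) (a ↑ʳ j)                 ≡⟨ ⊕-↑ʳ (select A₁ e₁ f₁ g₁) (select A₂ e₂ f₂ g₂) j ⟩
  a ↑ʳ (if lookup A₂ (e₂ j) then f₂ j else g₂ j)                        ≡⟨ if-float (a ↑ʳ_) (lookup A₂ (e₂ j)) ⟩
  (if lookup A₂ (e₂ j) then a ↑ʳ f₂ j else a ↑ʳ g₂ j)                   ≡⟨ cong₃-if (lookup-++ʳ A₁ A₂ (e₂ j)) (⊕-↑ʳ f₁ f₂ j) (⊕-↑ʳ g₁ g₂ j) ⟨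
  (if lookup (A₁ ++ᵥ A₂) (c ↑ʳ e₂ j) then (f₁ ⊕ f₂) (a ↑ʳ j) else (g₁ ⊕ g₂) (a ↑ʳ j))
                                                                         ≡⟨ cong (λ e → if lookup (A₁ ++ᵥ A₂) e then _ else _) (⊕-↑ʳ e₁ e₂ j) ⟨
  select (A₁ ++ᵥ A₂) (e₁ ⊕ e₂) (f₁ ⊕ f₂) (g₁ ⊕ g₂) (a ↑ʳ j)             ∎
  where open ≡-Reasoning

eulerGenus-partialDual-rawUnion : ∀ {H₁ H₂} → WellFormed H₁ → WellFormed H₂ → ∀ A₁ A₂ →
  eulerGenus (partialDual (rawUnion H₁ H₂) (A₁ ++ᵥ A₂)) ≡ eulerGenus (partialDual H₁ A₁) + eulerGenus (partialDual H₂ A₂)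
eulerGenus-partialDual-rawUnion {H₁} {H₂} wf₁ wf₂ A₁ A₂ = begin
  eulerGenus (partialDual (rawUnion H₁ H₂) (A₁ ++ᵥ A₂))
    ≡⟨ eulerGenus-cong (partialDual (rawUnion H₁ H₂) (A₁ ++ᵥ A₂))
         (select-⊕ A₁ A₂ (edge H₁) (edge H₂) (γ H₁) (α H₁) (γ H₂) (α H₂)) (λ _ → refl)
         (select-⊕ A₁ A₂ (edge H₁) (edge H₂) (α H₁) (γ H₁) (α H₂) (γ H₂)) ⟨
  eulerGenus (rawUnion P₁ P₂)
    ≡⟨ eulerGenus-rawUnion P₁ P₂ (genusBound P₁ (partialDual-involutive wf₁ A₁)) (genusBound P₂ (partialDual-involutive wf₂ A₂)) ⟩
  eulerGenus P₁ + eulerGenus P₂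
    ∎
  where
  open ≡-Reasoning
  P₁ P₂ : RawHypermap
  P₁ = partialDual H₁ A₁
  P₂ = partialDual H₂ A₂

⊕-respects : ∀ {a b c d} {f : Fin a → Fin a} {g : Fin b → Fin b} {e₁ : Fin a → Fin c} {e₂ : Fin b → Fin d} →
  (∀ i → e₁ (f i) ≡ e₁ i) → (∀ j → e₂ (g j) ≡ e₂ j) → ∀ z → (e₁ ⊕ e₂) ((f ⊕ g) z) ≡ (e₁ ⊕ e₂) z
⊕-respects {a} {b} {f = f} {g} {e₁} {e₂} resp₁ resp₂ z with splitView a b z
... | inl i = trans (cong (e₁ ⊕ e₂) (⊕-↑ˡ f g i)) (trans (⊕-↑ˡ e₁ e₂ (f i)) (trans (cong (_↑ˡ _) (resp₁ i)) (sym (⊕-↑ˡ e₁ e₂ i))))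
... | inr j = trans (cong (e₁ ⊕ e₂) (⊕-↑ʳ f g j)) (trans (⊕-↑ʳ e₁ e₂ (g j)) (trans (cong (_ ↑ʳ_) (resp₂ j)) (sym (⊕-↑ʳ e₁ e₂ j))))

rawUnion-wellFormed : ∀ {H₁ H₂} → WellFormed H₁ → WellFormed H₂ → WellFormed (rawUnion H₁ H₂)
rawUnion-wellFormed wf₁ wf₂ = record
  { involutive = record
    { α-inv = ⊕-involution W₁.α-inv W₂.α-inv ; β-inv = ⊕-involution W₁.β-inv W₂.β-inv ; γ-inv = ⊕-involution W₁.γ-inv W₂.γ-inv
    ; α-fpf = ⊕-fpf W₁.α-fpf W₂.α-fpf ; β-fpf = ⊕-fpf W₁.β-fpf W₂.β-fpf ; γ-fpf = ⊕-fpf W₁.γ-fpf W₂.γ-fpf }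
  ; edge-α = ⊕-respects W₁.edge-α W₂.edge-α
  ; edge-γ = ⊕-respects W₁.edge-γ W₂.edge-γ
  }
  where
  module W₁ = WellFormed wf₁
  module W₂ = WellFormed wf₂

eulerGenus-merge : ∀ {k k′ v v′ e f f′ d} → k ≡ suc k′ → v ≡ suc v′ → f ≡ suc f′ →
  (2 * k + d) ∸ (v + e + f) ≡ (2 * k′ + d) ∸ (v′ + e + f′)
eulerGenus-merge {k′ = k′} {v′ = v′} {e} {f′ = f′} {d} refl refl refl =
  cong₂ _∸_ (two-more k′ d) (regroup v′ e f′)
  where
  regroup : ∀ v e f → suc v + e + suc f ≡ 2 + (v + e + f)
  regroup = solve-∀

module Joint {H₁ H₂ : RawHypermap} (wf₁ : WellFormed H₁) (wf₂ : WellFormed H₂)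
             (x₁ : Fin (n H₁)) (x₂ : Fin (n H₂)) (A₁ : Subset (m H₁)) (A₂ : Subset (m H₂)) where

  private
    n₁ n₂ : ℕ
    n₁ = n H₁
    n₂ = n H₂
    module W₁ = WellFormed wf₁
    module W₂ = WellFormed wf₂

  PU PJ P₁ : RawHypermap
  PU = partialDual (rawUnion H₁ H₂) (A₁ ++ᵥ A₂)
  PJ = partialDual (rawJoint H₁ H₂ x₁ x₂) (A₁ ++ᵥ A₂)
  P₁ = partialDual H₁ A₁

  private
    αˡ : ∀ i → α PU (i ↑ˡ n₂) ≡ α P₁ i ↑ˡ n₂
    αˡ i = trans (sym (select-⊕ A₁ A₂ (edge H₁) (edge H₂) (γ H₁) (α H₁) (γ H₂) (α H₂) (i ↑ˡ n₂)))
                 (⊕-↑ˡ (α P₁) (α (partialDual H₂ A₂)) i)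
    βˡ : ∀ i → β PU (i ↑ˡ n₂) ≡ β P₁ i ↑ˡ n₂
    βˡ = ⊕-↑ˡ (β H₁) (β H₂)
    γˡ : ∀ i → γ PU (i ↑ˡ n₂) ≡ γ P₁ i ↑ˡ n₂
    γˡ i = trans (sym (select-⊕ A₁ A₂ (edge H₁) (edge H₂) (α H₁) (γ H₁) (α H₂) (γ H₂) (i ↑ˡ n₂)))
                 (⊕-↑ˡ (γ P₁) (γ (partialDual H₂ A₂)) i)

    module UP = Involutive (partialDual-involutive (rawUnion-wellFormed wf₁ wf₂) (A₁ ++ᵥ A₂))
    module P₁ = Involutive (partialDual-involutive wf₁ A₁)

    β⊕ : Fin (n₁ + n₂) → Fin (n₁ + n₂)
    β⊕ = β H₁ ⊕ β H₂

    merges : ∀ {gsO gsN : Generators (n₁ + n₂)} {gs₁ : Generators n₁} →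
      Replace β⊕ (β PJ) gsO gsN → All Involution gsO → Intertwines (_↑ˡ n₂) gs₁ gsO →
      ∀ {g} → Involution g → FixedPointFree g → (∀ z → Step gsN (z ↑ˡ n₂) (g z ↑ˡ n₂)) →
      orbits gsO ≡ suc (orbits gsN)
    merges {gsO} {gsN} rep invO left {g} g-inv g-fpf g-step = S.orbits-merge apart joined
      where
      module S = Surgery (⊕-involution W₁.β-inv W₂.β-inv) (⊕-fpf W₁.β-fpf W₂.β-fpf)
                   (⊕-↑ˡ (β H₁) (β H₂) x₁) (⊕-↑ʳ (β H₁) (β H₂) x₂) (↑ˡ≢↑ʳ x₁ x₂) (↑ˡ≢↑ʳ (β H₁ x₁) x₂) rep invO
      apart : ¬ T (S.old (x₁ ↑ˡ n₂) (n₁ ↑ʳ x₂))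
      apart old-xy = let _ , eq , _ = reach-preimage left (sameOrbit-sound gsO old-xy) in ↑ˡ≢↑ʳ _ x₂ (sym eq)
      Lifted : Fin n₁ → Fin n₁ → Set
      Lifted z w = Reach gsN (z ↑ˡ n₂) (w ↑ˡ n₂)
      β-step : ∀ z → z ≢ x₁ → z ≢ β H₁ x₁ → Lifted z (β H₁ z)
      β-step z z≢x₁ z≢βx₁ = return (subst (Step gsN (z ↑ˡ n₂))
        (trans (S.h′-other (z ↑ˡ n₂) (z≢x₁ ∘ ↑ˡ-injective n₂ z x₁) (↑ˡ≢↑ʳ z x₂) (z≢βx₁ ∘ ↑ˡ-injective n₂ z _) (↑ˡ≢↑ʳ z _))
               (⊕-↑ˡ (β H₁) (β H₂) z))
        (replaced-step rep (z ↑ˡ n₂)))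
      joined : T (S.new (x₁ ↑ˡ n₂) (β H₁ x₁ ↑ˡ n₂))
      joined = sameOrbit-complete gsN (fold Lifted _◅◅_ ε
        (AlternatingWalk.path-to-h g-inv W₁.β-inv g-fpf W₁.β-fpf x₁ Lifted
          (λ z _ → return (g-step z)) (λ z _ → β-step z)))

  eulerGenus-rawJoint : eulerGenus PJ ≡ eulerGenus PU
  eulerGenus-rawJoint = sym (eulerGenus-merge
    (cong (_+ iso PU) (merges (skip at-head) (UP.α-inv ∷ UP.β-inv ∷ UP.γ-inv ∷ []) (αˡ ∷ βˡ ∷ γˡ ∷ [])
                              P₁.α-inv P₁.α-fpf (λ z → here (αˡ z))))
    (cong (_+ iso PU) (merges (skip at-head) (UP.α-inv ∷ UP.β-inv ∷ []) (αˡ ∷ βˡ ∷ [])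
                              P₁.α-inv P₁.α-fpf (λ z → here (αˡ z))))
    (cong (_+ iso PU) (merges at-head (UP.β-inv ∷ UP.γ-inv ∷ []) (βˡ ∷ γˡ ∷ [])
                              P₁.γ-inv P₁.γ-fpf (λ z → there (here (γˡ z))))))

eulerGenus-partialDual-rawJoint : ∀ {H₁ H₂} → WellFormed H₁ → WellFormed H₂ → ∀ x₁ x₂ A →
  eulerGenus (partialDual (rawJoint H₁ H₂ x₁ x₂) A) ≡ eulerGenus (partialDual (rawUnion H₁ H₂) A)
eulerGenus-partialDual-rawJoint {H₁} wf₁ wf₂ x₁ x₂ A with splitAtᵥ (m H₁) A
... | A₁ , A₂ , refl = Joint.eulerGenus-rawJoint wf₁ wf₂ x₁ x₂ A₁ A₂

proposition4p4 : (H₁ H₂ : Hypermap) (x₁ : Fin (n (carrier H₁))) (x₂ : Fin (n (carrier H₂))) →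
    (∀ k → partialDualPoly (rawUnion (carrier H₁) (carrier H₂)) k
             ≡ partialDualPoly (rawJoint (carrier H₁) (carrier H₂) x₁ x₂) k)
    × (∀ k → partialDualPoly (rawJoint (carrier H₁) (carrier H₂) x₁ x₂) k
             ≡ (partialDualPoly (carrier H₁) ⊛ partialDualPoly (carrier H₂)) k)
proposition4p4 H₁ H₂ x₁ x₂ = union≡joint , λ k → trans (sym (union≡joint k)) (union≡product k)
  where
  wf₁ : WellFormed (carrier H₁)
  wf₁ = hypermap-wellFormed H₁
  wf₂ : WellFormed (carrier H₂)
  wf₂ = hypermap-wellFormed H₂
  union≡joint : ∀ k → partialDualPoly (rawUnion (carrier H₁) (carrier H₂)) k
                    ≡ partialDualPoly (rawJoint (carrier H₁) (carrier H₂) x₁ x₂) k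
  union≡joint = count-cong (sym ∘ eulerGenus-partialDual-rawJoint wf₁ wf₂ x₁ x₂) (allSubsets (m (carrier H₁) + m (carrier H₂)))
  union≡product : ∀ k → partialDualPoly (rawUnion (carrier H₁) (carrier H₂)) k
                      ≡ (partialDualPoly (carrier H₁) ⊛ partialDualPoly (carrier H₂)) k
  union≡product = count-allSubsets-⊛ (m (carrier H₁)) (m (carrier H₂)) _ _ _ (eulerGenus-partialDual-rawUnion wf₁ wf₂)
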